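{- Let $n$ be a positive integer divisible by $8$, and let $\mathcal{C}_1\subset\mathcal{C}_2\subset\mathcal{C}_1^\perp$ be binary codes of length $n$ with $\mathcal{C}_1$ doubly even, $\mathbf{1}\in\mathcal{C}_1$, $\dim\mathcal{C}_1=k_1$ and $\dim\mathcal{C}_2=k_1+k_2$. Then the number of quaternary even codes $\mathcal{C}$ of length $n$ containing $\mathbf{1}$ such that $\pi(\mathcal{C})=\mathcal{C}_1$ and $\iota^{ -1}(\mathcal{C})=\mathcal{C}_2$ is $2^{(k_1-1)(2n-3k_1-2-2k_2)/2}$.
   Context: $\mathbf{1}$ is the all-ones vector. A quaternary code is a $\mathbf{Z}_4$-submodule of $\mathbf{Z}_4^n$. The Euclidean weight on $\mathbf{Z}_4$ is $\mathrm{wt}_e(0)=0$, $\mathrm{wt}_e(\pm1)=1$, $\mathrm{wt}_e(2)=4$, extended additively; a quaternary code is even if all codewords have Euclidean weight divisible by $8$. $\pi:\mathbf{Z}_4^n\to\mathbf{Z}_2^n$ is reduction mod $2$ and $\iota:\mathbf{Z}_2^n\to\mathbf{Z}_4^n$, $x\mapsto 2x$, is the coordinatewise injection; $\pi(\mathcal{C})$ is the residue code and $\iota^{ -1}(\mathcal{C})$ the torsion code. A binary code is doubly even if all Hamming weights are divisible by $4$; duals are with respect to the standard inner product. -}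

module Defs where

open import Data.Nat using (ℕ; zero; suc; _+_; _*_)
open import Data.Nat.Divisibility using (_∣_)
open import Data.Bool using (Bool; true; false; _xor_; _∧_; if_then_else_)
open import Data.Vec using (Vec; []; _∷_; map; zipWith; foldr; replicate; lookup)
open import Data.Fin using (Fin)
open import Data.Product using (Σ; ∃; _×_)
open import Relation.Binary.PropositionalEquality using (_≡_)
open import Function.Bundles using (_⇔_)

data ℤ₄ : Set where
  z0 z1 z2 z3 : ℤ₄

toℕ₄ : ℤ₄ → ℕ
toℕ₄ z0 = 0
toℕ₄ z1 = 1
toℕ₄ z2 = 2
toℕ₄ z3 = 3

fromℕ₄ : ℕ → ℤ₄
fromℕ₄ 0 = z0
fromℕ₄ 1 = z1
fromℕ₄ 2 = z2
fromℕ₄ 3 = z3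
fromℕ₄ (suc (suc (suc (suc k)))) = fromℕ₄ k

_+₄_ : ℤ₄ → ℤ₄ → ℤ₄
a +₄ b = fromℕ₄ (toℕ₄ a + toℕ₄ b)

_*₄_ : ℤ₄ → ℤ₄ → ℤ₄
a *₄ b = fromℕ₄ (toℕ₄ a * toℕ₄ b)

wtE₄ : ℤ₄ → ℕ
wtE₄ z0 = 0
wtE₄ z1 = 1
wtE₄ z2 = 4
wtE₄ z3 = 1

Word₂ : ℕ → Set
Word₂ n = Vec Bool n

Word₄ : ℕ → Set
Word₄ n = Vec ℤ₄ n

Code₂ : ℕ → Set
Code₂ n = Word₂ n → Bool

Code₄ : ℕ → Set
Code₄ n = Word₄ n → Bool

zero₂ : ∀ {n} → Word₂ n
zero₂ = replicate _ false

zero₄ : ∀ {n} → Word₄ n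
zero₄ = replicate _ z0

one₂ : ∀ {n} → Word₂ n
one₂ = replicate _ true

one₄ : ∀ {n} → Word₄ n
one₄ = replicate _ z1

_⊕_ : ∀ {n} → Word₂ n → Word₂ n → Word₂ n
_⊕_ = zipWith _xor_

_+ᵥ_ : ∀ {n} → Word₄ n → Word₄ n → Word₄ n
_+ᵥ_ = zipWith _+₄_

_·ᵥ_ : ∀ {n} → ℤ₄ → Word₄ n → Word₄ n
a ·ᵥ x = map (a *₄_) x

dot₂ : ∀ {n} → Word₂ n → Word₂ n → Bool
dot₂ x y = foldr _ _xor_ false (zipWith _∧_ x y)

wtH : ∀ {n} → Word₂ n → ℕ
wtH x = foldr _ (λ b s → (if b then 1 else 0) + s) 0 x

wtE : ∀ {n} → Word₄ n → ℕ
wtE x = foldr _ (λ a s → wtE₄ a + s) 0 x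

π₂ : ℤ₄ → Bool
π₂ z0 = false
π₂ z1 = true
π₂ z2 = false
π₂ z3 = true

π : ∀ {n} → Word₄ n → Word₂ n
π = map π₂

ι : ∀ {n} → Word₂ n → Word₄ n
ι = map (λ b → if b then z2 else z0)

record IsBinaryLinear {n} (C : Code₂ n) : Set where
  field
    has-zero : C zero₂ ≡ true
    closed-⊕ : ∀ x y → C x ≡ true → C y ≡ true → C (x ⊕ y) ≡ true

lincomb : ∀ {n k} → Vec Bool k → Vec (Word₂ n) k → Word₂ n
lincomb [] [] = zero₂
lincomb (c ∷ cs) (b ∷ bs) = (if c then b else zero₂) ⊕ lincomb cs bs

HasDim : ∀ {n} → Code₂ n → ℕ → Set
HasDim {n} C k = Σ (Vec (Word₂ n) k) λ b →
  (∀ x → (C x ≡ true) ⇔ (∃ λ c → lincomb c b ≡ x)) ×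
  (∀ c → lincomb c b ≡ zero₂ → c ≡ replicate k false)

_⊆₂_ : ∀ {n} → Code₂ n → Code₂ n → Set
C ⊆₂ D = ∀ x → C x ≡ true → D x ≡ true

_∈⊥_ : ∀ {n} → Word₂ n → Code₂ n → Set
y ∈⊥ C = ∀ x → C x ≡ true → dot₂ x y ≡ false

DoublyEven : ∀ {n} → Code₂ n → Set
DoublyEven C = ∀ x → C x ≡ true → 4 ∣ wtH x

record IsQuaternaryCode {n} (C : Code₄ n) : Set where
  field
    has-zero : C zero₄ ≡ true
    closed-+ : ∀ x y → C x ≡ true → C y ≡ true → C (x +ᵥ y) ≡ true
    closed-· : ∀ a x → C x ≡ true → C (a ·ᵥ x) ≡ true

EvenCode₄ : ∀ {n} → Code₄ n → Set
EvenCode₄ C = ∀ x → C x ≡ true → 8 ∣ wtE x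

ResidueIs : ∀ {n} → Code₄ n → Code₂ n → Set
ResidueIs C D = ∀ y → (D y ≡ true) ⇔ (∃ λ x → C x ≡ true × π x ≡ y)

TorsionIs : ∀ {n} → Code₄ n → Code₂ n → Set
TorsionIs C D = ∀ y → (D y ≡ true) ⇔ (C (ι y) ≡ true)

SameCode₄ : ∀ {n} → Code₄ n → Code₄ n → Set
SameCode₄ C D = ∀ x → C x ≡ D x

NumberOfCodes₄ : ∀ {n} → (Code₄ n → Set) → ℕ → Set
NumberOfCodes₄ {n} P N = Σ (Vec (Code₄ n) N) λ cs →
  (∀ i → P (lookup cs i)) ×
  (∀ i j → SameCode₄ (lookup cs i) (lookup cs j) → i ≡ j) ×
  (∀ C → P C → ∃ λ i → SameCode₄ C (lookup cs i))

-- A quaternary code C with residue C₁ and torsion C₂ is generated by ι(C₂) and one lift cᵢ + 2mᵢ of each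
-- vector of a basis 𝟏, c₁, …, c_k of C₁ (k = k₁ − 1), where 𝟏 ∈ C lifts 𝟏 and each mᵢ only matters modulo
-- C₂, that is through a word yᵢ of a complement of C₂, of dimension M = n − k₁ − k₂.  C is even exactly
-- when its generators have Euclidean weight 0 mod 8 and are pairwise orthogonal mod 4.  For the lift of cᵢ
-- these are affine equations in yᵢ, one for each of 𝟏, cᵢ, cᵢ₊₁, …, c_k, whose right-hand sides only depend
-- on the later lifts and whose left-hand sides are independent on the complement because C₁ ⊆ C₂ ⊆ C₁^⊥.
-- Solving them from the last lift upwards, yᵢ ranges over 2^(R + i − 1) values with R = M − k₁, so there
-- are 2^e codes with e = kR + k(k − 1)/2, i.e. 2e = (k₁ − 1)(2n − 3k₁ − 2 − 2k₂).

module Submission where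

open import Defs
open import Algebra.Bundles using (CommutativeSemigroup)
open import Algebra.Core using (Op₂)
open import Algebra.Definitions using (Associative; Commutative; Interchangable)
import Algebra.Properties.CommutativeSemigroup as CommutativeSemigroupProperties
open import Data.Bool using (Bool; true; false; not; _∧_; _xor_; if_then_else_)
import Data.Bool.Properties as Bool
open import Data.Bool.Properties using (xor-assoc; xor-comm; xor-identityʳ; xor-same; ∧-distribʳ-xor; ∧-comm; ∧-identityʳ)
open import Data.Empty using (⊥-elim)
open import Data.Fin using (Fin; zero; suc; toℕ; fromℕ<; combine; remQuot)
import Data.Fin.Properties as Fin
open import Data.Fin.Properties using (remQuot-combine; combine-remQuot)
open import Data.Fin.Subset.Properties using (anySubset?)
open import Data.Nat using (ℕ; zero; suc; _+_; _^_; _<_)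
import Data.Nat as ℕ
open import Data.Nat.DivMod using (_%_; m%n<n; %-distribˡ-+)
open import Data.Nat.Divisibility using (_∣_; divides; m%n≡0⇔n∣m)
open import Data.Nat.Properties using (+-suc; +-identityʳ; +-cancelʳ-≡; +-comm)
import Data.Nat.Solver
open import Data.Integer using (ℤ; +_; _-_; _*_)
import Data.Integer as ℤ
import Data.Integer.Properties as ℤP
import Data.Integer.Solver
open import Data.Product using (Σ; ∃; _×_; _,_; proj₁; proj₂; uncurry)
open import Data.Unit using (⊤; tt)
open import Data.Vec using (Vec; []; _∷_; map; zipWith; foldr; replicate; head; tail; _++_; take; drop; lookup; tabulate)
import Data.Vec.Properties as Vec
open import Data.Vec.Properties
  using (zipWith-assoc; zipWith-comm; zipWith-identityˡ; zipWith-identityʳ; map-++; ++-injectiveˡ; ++-injectiveʳ; lookup-map;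
         take++drop≡id; lookup∘tabulate; lookup-zipWith; tabulate∘lookup; tabulate-cong)
open import Data.Vec.Relation.Unary.All using (All; []; _∷_)
import Data.Vec.Relation.Unary.All as All
import Data.Vec.Relation.Unary.All.Properties as All
open import Data.Vec.Relation.Unary.AllPairs using (AllPairs; []; _∷_)
import Data.Vec.Relation.Unary.AllPairs as AllPairs
open import Function using (_∘_)
open import Function.Bundles using (_⇔_; mk⇔; Equivalence)
open import Function.Construct.Composition using (_⇔-∘_)
open import Level using (0ℓ)
open import Relation.Binary.Definitions using (DecidableEquality)
open import Relation.Binary.PropositionalEquality
open import Relation.Binary.PropositionalEquality.Algebra using (isMagma)
open import Relation.Nullary using (¬_)
open import Relation.Nullary.Decidable using (Dec; yes; does; map′; from-yes; _×-dec_; _→-dec_; dec-true)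
open import Relation.Unary using (Decidable)
open ≡-Reasoning

≡-commutativeSemigroup : {A : Set} (_∙_ : Op₂ A) → Associative _≡_ _∙_ → Commutative _≡_ _∙_ → CommutativeSemigroup 0ℓ 0ℓ
≡-commutativeSemigroup _∙_ assoc comm = record
  { isCommutativeSemigroup = record { isSemigroup = record { isMagma = isMagma _∙_ ; assoc = assoc } ; comm = comm } }

-- Identities between values of Bool, ℤ₄ and ℤ/8ℤ are proved by evaluating these decision procedures

allBool? : {P : Bool → Set} → Decidable P → Dec (∀ b → P b)
allBool? P? = map′ (λ { (p₁ , p₀) → λ { true → p₁ ; false → p₀ } }) (λ p → p true , p false)
                   (P? true ×-dec P? false)

allℤ₄? : {P : ℤ₄ → Set} → Decidable P → Dec (∀ a → P a)
allℤ₄? P? = map′ (λ { (p₀ , p₁ , p₂ , p₃) → λ { z0 → p₀ ; z1 → p₁ ; z2 → p₂ ; z3 → p₃ } })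
                 (λ p → p z0 , p z1 , p z2 , p z3)
                 (P? z0 ×-dec P? z1 ×-dec P? z2 ×-dec P? z3)

fromℕ₄-toℕ₄ : ∀ a → fromℕ₄ (toℕ₄ a) ≡ a
fromℕ₄-toℕ₄ z0 = refl
fromℕ₄-toℕ₄ z1 = refl
fromℕ₄-toℕ₄ z2 = refl
fromℕ₄-toℕ₄ z3 = refl

infix 4 _≟₄_
_≟₄_ : DecidableEquality ℤ₄
a ≟₄ b = map′ (λ e → trans (sym (fromℕ₄-toℕ₄ a)) (trans (cong fromℕ₄ e) (fromℕ₄-toℕ₄ b)))
              (cong toℕ₄) (toℕ₄ a ℕ.≟ toℕ₄ b)

ι₄ : Bool → ℤ₄
ι₄ b = if b then z2 else z0

high₂ : ℤ₄ → Bool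
high₂ z0 = false
high₂ z1 = false
high₂ z2 = true
high₂ z3 = true

-- lift₄ c m = c + 2m
lift₄ : Bool → Bool → ℤ₄
lift₄ false m = ι₄ m
lift₄ true  m = if m then z3 else z1

+₄-comm : ∀ a b → a +₄ b ≡ b +₄ a
+₄-comm = from-yes (allℤ₄? λ a → allℤ₄? λ b → a +₄ b ≟₄ b +₄ a)

+₄-assoc : ∀ a b c → (a +₄ b) +₄ c ≡ a +₄ (b +₄ c)
+₄-assoc = from-yes (allℤ₄? λ a → allℤ₄? λ b → allℤ₄? λ c → (a +₄ b) +₄ c ≟₄ a +₄ (b +₄ c))

+₄-interchange : ∀ w x y z → (w +₄ x) +₄ (y +₄ z) ≡ (w +₄ y) +₄ (x +₄ z)
+₄-interchange = CommutativeSemigroupProperties.interchange (≡-commutativeSemigroup _+₄_ +₄-assoc +₄-comm)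

+₄-identityˡ : ∀ a → z0 +₄ a ≡ a
+₄-identityˡ = from-yes (allℤ₄? λ a → z0 +₄ a ≟₄ a)

+₄-identityʳ : ∀ a → a +₄ z0 ≡ a
+₄-identityʳ = from-yes (allℤ₄? λ a → a +₄ z0 ≟₄ a)

*₄-comm : ∀ a b → a *₄ b ≡ b *₄ a
*₄-comm = from-yes (allℤ₄? λ a → allℤ₄? λ b → a *₄ b ≟₄ b *₄ a)

*₄-distribʳ-+₄ : ∀ a b c → (a +₄ b) *₄ c ≡ (a *₄ c) +₄ (b *₄ c)
*₄-distribʳ-+₄ = from-yes (allℤ₄? λ a → allℤ₄? λ b → allℤ₄? λ c → (a +₄ b) *₄ c ≟₄ (a *₄ c) +₄ (b *₄ c))

*₄-zeroˡ : ∀ a → z0 *₄ a ≡ z0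
*₄-zeroˡ = from-yes (allℤ₄? λ a → z0 *₄ a ≟₄ z0)

+₄-*₄-z3 : ∀ a → a +₄ (z3 *₄ a) ≡ z0
+₄-*₄-z3 = from-yes (allℤ₄? λ a → a +₄ (z3 *₄ a) ≟₄ z0)

infixr 8 _×₄_
_×₄_ : ℕ → ℤ₄ → ℤ₄
zero  ×₄ a = z0
suc k ×₄ a = a +₄ (k ×₄ a)

*₄-as-× : ∀ a b → a *₄ b ≡ toℕ₄ a ×₄ b
*₄-as-× = from-yes (allℤ₄? λ a → allℤ₄? λ b → a *₄ b ≟₄ toℕ₄ a ×₄ b)

π₂-+₄ : ∀ a b → π₂ (a +₄ b) ≡ π₂ a xor π₂ b
π₂-+₄ = from-yes (allℤ₄? λ a → allℤ₄? λ b → π₂ (a +₄ b) Bool.≟ π₂ a xor π₂ b)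

π₂-*₄ : ∀ a b → π₂ (a *₄ b) ≡ π₂ a ∧ π₂ b
π₂-*₄ = from-yes (allℤ₄? λ a → allℤ₄? λ b → π₂ (a *₄ b) Bool.≟ π₂ a ∧ π₂ b)

lift₄-π₂-high₂ : ∀ a → lift₄ (π₂ a) (high₂ a) ≡ a
lift₄-π₂-high₂ = from-yes (allℤ₄? λ a → lift₄ (π₂ a) (high₂ a) ≟₄ a)

π₂-lift₄ : ∀ c m → π₂ (lift₄ c m) ≡ c
π₂-lift₄ = from-yes (allBool? λ c → allBool? λ m → π₂ (lift₄ c m) Bool.≟ c)

high₂-lift₄ : ∀ c m → high₂ (lift₄ c m) ≡ m
high₂-lift₄ = from-yes (allBool? λ c → allBool? λ m → high₂ (lift₄ c m) Bool.≟ m)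

lift₄-+₄-ι₄ : ∀ c m b → lift₄ c m +₄ ι₄ b ≡ lift₄ c (m xor b)
lift₄-+₄-ι₄ = from-yes (allBool? λ c → allBool? λ m → allBool? λ b → lift₄ c m +₄ ι₄ b ≟₄ lift₄ c (m xor b))

lift₄-+₄-lift₄ : ∀ c m m′ → lift₄ c m +₄ lift₄ c m′ ≡ ι₄ ((m xor m′) xor c)
lift₄-+₄-lift₄ = from-yes (allBool? λ c → allBool? λ m → allBool? λ m′ → lift₄ c m +₄ lift₄ c m′ ≟₄ ι₄ ((m xor m′) xor c))

ι₄-*₄ : ∀ b a → ι₄ b *₄ a ≡ ι₄ (b ∧ π₂ a)
ι₄-*₄ = from-yes (allBool? λ b → allℤ₄? λ a → ι₄ b *₄ a ≟₄ ι₄ (b ∧ π₂ a))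

lift₄-*₄ : ∀ c m c′ m′ → lift₄ c m *₄ lift₄ c′ m′ ≡ (lift₄ c false *₄ lift₄ c′ false) +₄ ι₄ ((m ∧ c′) xor (c ∧ m′))
lift₄-*₄ = from-yes (allBool? λ c → allBool? λ m → allBool? λ c′ → allBool? λ m′ →
  lift₄ c m *₄ lift₄ c′ m′ ≟₄ (lift₄ c false *₄ lift₄ c′ false) +₄ ι₄ ((m ∧ c′) xor (c ∧ m′)))

ι₄-injective : ∀ {a b} → ι₄ a ≡ ι₄ b → a ≡ b
ι₄-injective {true}  {true}  _ = refl
ι₄-injective {false} {false} _ = refl

ℤ₈ : Set
ℤ₈ = Fin 8

[_]₈ : ℕ → ℤ₈
[ k ]₈ = fromℕ< (m%n<n k 8)

infix 20 _+₈_
_+₈_ : ℤ₈ → ℤ₈ → ℤ₈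
a +₈ b = [ toℕ a + toℕ b ]₈

+₈-assoc : ∀ a b c → (a +₈ b) +₈ c ≡ a +₈ (b +₈ c)
+₈-assoc = from-yes (Fin.all? λ a → Fin.all? λ b → Fin.all? λ c → (a +₈ b) +₈ c Fin.≟ a +₈ (b +₈ c))

+₈-comm : ∀ a b → a +₈ b ≡ b +₈ a
+₈-comm a b = cong [_]₈ (+-comm (toℕ a) (toℕ b))

+₈-interchange : ∀ w x y z → (w +₈ x) +₈ (y +₈ z) ≡ (w +₈ y) +₈ (x +₈ z)
+₈-interchange = CommutativeSemigroupProperties.interchange (≡-commutativeSemigroup _+₈_ +₈-assoc +₈-comm)

+₈-identityˡ : ∀ a → [ 0 ]₈ +₈ a ≡ a
+₈-identityˡ = from-yes (Fin.all? λ a → [ 0 ]₈ +₈ a Fin.≟ a)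

[]₈-cong : ∀ {m n} → m % 8 ≡ n % 8 → [ m ]₈ ≡ [ n ]₈
[]₈-cong {m} {n} e = Fin.fromℕ<-cong _ _ e (m%n<n m 8) (m%n<n n 8)

[]₈-+ : ∀ m n → [ m + n ]₈ ≡ [ m ]₈ +₈ [ n ]₈
[]₈-+ m n = []₈-cong {m + n} {toℕ [ m ]₈ + toℕ [ n ]₈} (begin
  (m + n) % 8                                            ≡⟨ %-distribˡ-+ m n 8 ⟩
  (m % 8 + n % 8) % 8                                    ≡⟨ cong₂ (λ x y → (x + y) % 8) (Fin.toℕ-fromℕ< (m%n<n m 8)) (Fin.toℕ-fromℕ< (m%n<n n 8)) ⟨
  (toℕ [ m ]₈ + toℕ [ n ]₈) % 8                          ∎)

[]₈≡0⇔8∣ : ∀ k → [ k ]₈ ≡ [ 0 ]₈ ⇔ 8 ∣ k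
[]₈≡0⇔8∣ k = mk⇔ (λ e → Equivalence.to (m%n≡0⇔n∣m k 8) (trans (sym (Fin.toℕ-fromℕ< (m%n<n k 8))) (cong toℕ e)))
                 (λ 8∣k → []₈-cong {k} {0} (Equivalence.from (m%n≡0⇔n∣m k 8) 8∣k))

wt₈ : ℤ₄ → ℤ₈
wt₈ a = [ wtE₄ a ]₈

-- 2a mod 8, well defined for a mod 4
double₈ : ℤ₄ → ℤ₈
double₈ a = [ 2 ℕ.* toℕ₄ a ]₈

four₈ : Bool → ℤ₈
four₈ b = [ if b then 4 else 0 ]₈

wt₈-+₄ : ∀ a b → wt₈ (a +₄ b) ≡ (wt₈ a +₈ wt₈ b) +₈ double₈ (a *₄ b)
wt₈-+₄ = from-yes (allℤ₄? λ a → allℤ₄? λ b → wt₈ (a +₄ b) Fin.≟ (wt₈ a +₈ wt₈ b) +₈ double₈ (a *₄ b))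

double₈-+₄ : ∀ a b → double₈ (a +₄ b) ≡ double₈ a +₈ double₈ b
double₈-+₄ = from-yes (allℤ₄? λ a → allℤ₄? λ b → double₈ (a +₄ b) Fin.≟ double₈ a +₈ double₈ b)

double₈≡0⇒≡z0 : ∀ a → double₈ a ≡ [ 0 ]₈ → a ≡ z0
double₈≡0⇒≡z0 = from-yes (allℤ₄? λ a → (double₈ a Fin.≟ [ 0 ]₈) →-dec (a ≟₄ z0))

wt₈-ι₄ : ∀ b → wt₈ (ι₄ b) ≡ four₈ b
wt₈-ι₄ = from-yes (allBool? λ b → wt₈ (ι₄ b) Fin.≟ four₈ b)

four₈-xor : ∀ a b → four₈ (a xor b) ≡ four₈ a +₈ four₈ b
four₈-xor = from-yes (allBool? λ a → allBool? λ b → four₈ (a xor b) Fin.≟ four₈ a +₈ four₈ b)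

wt₈-lift₄ : ∀ c m → wt₈ (lift₄ c m) ≡ [ if c then 1 else 0 ]₈ +₈ four₈ (m ∧ not c)
wt₈-lift₄ = from-yes (allBool? λ c → allBool? λ m → wt₈ (lift₄ c m) Fin.≟ [ if c then 1 else 0 ]₈ +₈ four₈ (m ∧ not c))

four₈-cancel : ∀ a b → four₈ a +₈ four₈ b ≡ [ 0 ]₈ ⇔ b ≡ a
four₈-cancel a b = mk⇔ (from-yes (allBool? λ a → allBool? λ b → (four₈ a +₈ four₈ b Fin.≟ [ 0 ]₈) →-dec (b Bool.≟ a)) a b)
                       (from-yes (allBool? λ a → allBool? λ b → (b Bool.≟ a) →-dec (four₈ a +₈ four₈ b Fin.≟ [ 0 ]₈)) a b)

is4₈ : ℤ₈ → Bool
is4₈ x = does (x Fin.≟ [ 4 ]₈)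

4∣⇒≡four₈ : ∀ k → 4 ∣ k → [ k ]₈ ≡ four₈ (is4₈ [ k ]₈)
4∣⇒≡four₈ _ (divides q refl) = go q
  where
  step : ∀ x → x ≡ four₈ (is4₈ x) → [ 4 ]₈ +₈ x ≡ four₈ (is4₈ ([ 4 ]₈ +₈ x))
  step = from-yes (Fin.all? λ x → (x Fin.≟ four₈ (is4₈ x)) →-dec ([ 4 ]₈ +₈ x Fin.≟ four₈ (is4₈ ([ 4 ]₈ +₈ x))))
  go : ∀ q → [ q ℕ.* 4 ]₈ ≡ four₈ (is4₈ [ q ℕ.* 4 ]₈)
  go zero    = refl
  go (suc q) = trans ([]₈-+ 4 (q ℕ.* 4)) (trans (step _ (go q)) (cong (four₈ ∘ is4₈) (sym ([]₈-+ 4 (q ℕ.* 4)))))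

-- Linear algebra over 𝔽₂

module _ {n : ℕ} where

  ⊕-assoc : Associative _≡_ (_⊕_ {n})
  ⊕-assoc = zipWith-assoc xor-assoc

  ⊕-comm : Commutative _≡_ (_⊕_ {n})
  ⊕-comm = zipWith-comm xor-comm

  ⊕-identityˡ : ∀ (x : Word₂ n) → zero₂ ⊕ x ≡ x
  ⊕-identityˡ = zipWith-identityˡ λ _ → refl

  ⊕-identityʳ : ∀ (x : Word₂ n) → x ⊕ zero₂ ≡ x
  ⊕-identityʳ = zipWith-identityʳ xor-identityʳ

  ⊕-interchange : Interchangable _≡_ (_⊕_ {n}) _⊕_
  ⊕-interchange = CommutativeSemigroupProperties.interchange (≡-commutativeSemigroup _⊕_ ⊕-assoc ⊕-comm)

⊕-self : ∀ {n} (x : Word₂ n) → x ⊕ x ≡ zero₂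
⊕-self []      = refl
⊕-self (a ∷ x) = cong₂ _∷_ (xor-same a) (⊕-self x)

⊕-cancelˡ : ∀ {n} (x y : Word₂ n) → x ⊕ (x ⊕ y) ≡ y
⊕-cancelˡ x y = begin
  x ⊕ (x ⊕ y)   ≡⟨ ⊕-assoc x x y ⟨
  (x ⊕ x) ⊕ y   ≡⟨ cong (_⊕ y) (⊕-self x) ⟩
  zero₂ ⊕ y     ≡⟨ ⊕-identityˡ y ⟩
  y             ∎

⊕-cancelʳ : ∀ {n} (x y : Word₂ n) → (x ⊕ y) ⊕ y ≡ x
⊕-cancelʳ x y = trans (⊕-comm (x ⊕ y) y) (trans (cong (y ⊕_) (⊕-comm x y)) (⊕-cancelˡ y x))

⊕≡0⇒≡ : ∀ {n} {x y : Word₂ n} → x ⊕ y ≡ zero₂ → x ≡ y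
⊕≡0⇒≡ {x = x} {y} e = trans (sym (⊕-cancelʳ x y)) (trans (cong (_⊕ y) e) (⊕-identityˡ y))

⊕-swap : ∀ {n} (x y z : Word₂ n) → x ⊕ (y ⊕ z) ≡ y ⊕ (x ⊕ z)
⊕-swap = CommutativeSemigroupProperties.x∙yz≈y∙xz (≡-commutativeSemigroup _⊕_ ⊕-assoc ⊕-comm)

≡⇒⊕≡0 : ∀ {n} {x y : Word₂ n} → x ≡ y → x ⊕ y ≡ zero₂
≡⇒⊕≡0 {x = x} refl = ⊕-self x

⊕≡⇒≡⊕ : ∀ {n} {x y z : Word₂ n} → x ⊕ y ≡ z → x ≡ z ⊕ y
⊕≡⇒≡⊕ {x = x} {y} refl = sym (⊕-cancelʳ x y)

infixr 25 _·₂_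
_·₂_ : ∀ {n} → Bool → Word₂ n → Word₂ n
b ·₂ x = if b then x else zero₂

·₂-⊕ : ∀ {n} b (x y : Word₂ n) → b ·₂ (x ⊕ y) ≡ (b ·₂ x) ⊕ (b ·₂ y)
·₂-⊕ true  x y = refl
·₂-⊕ false x y = sym (⊕-identityˡ zero₂)

xor-·₂ : ∀ {n} a b (x : Word₂ n) → (a xor b) ·₂ x ≡ (a ·₂ x) ⊕ (b ·₂ x)
xor-·₂ true  true  x = sym (⊕-self x)
xor-·₂ true  false x = sym (⊕-identityʳ x)
xor-·₂ false b     x = sym (⊕-identityˡ _)

Span : ∀ {n k} → Vec (Word₂ n) k → Word₂ n → Set
Span v x = ∃ λ c → lincomb c v ≡ x

Independent : ∀ {n k} → Vec (Word₂ n) k → Set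
Independent {k = k} v = ∀ c → lincomb c v ≡ zero₂ → c ≡ replicate k false

lincomb-zero : ∀ {n k} (v : Vec (Word₂ n) k) → lincomb zero₂ v ≡ zero₂
lincomb-zero []      = refl
lincomb-zero (b ∷ v) = trans (⊕-identityˡ _) (lincomb-zero v)

lincomb-⊕ : ∀ {n k} (c c' : Vec Bool k) (v : Vec (Word₂ n) k) →
            lincomb (c ⊕ c') v ≡ lincomb c v ⊕ lincomb c' v
lincomb-⊕ []       []       []      = sym (⊕-identityˡ zero₂)
lincomb-⊕ (a ∷ c) (a' ∷ c') (x ∷ v) =
  trans (cong₂ _⊕_ (xor-·₂ a a' x) (lincomb-⊕ c c' v)) (⊕-interchange (a ·₂ x) (a' ·₂ x) _ _)

lincomb-·₂ : ∀ {n k} b (c : Vec Bool k) (v : Vec (Word₂ n) k) → lincomb (b ·₂ c) v ≡ b ·₂ lincomb c v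
lincomb-·₂ true  c v = refl
lincomb-·₂ false c v = lincomb-zero v

lincomb-++ : ∀ {n k j} (c : Vec Bool k) (c' : Vec Bool j) (u : Vec (Word₂ n) k) (v : Vec (Word₂ n) j) →
             lincomb (c ++ c') (u ++ v) ≡ lincomb c u ⊕ lincomb c' v
lincomb-++ []      c' []      v = sym (⊕-identityˡ _)
lincomb-++ (a ∷ c) c' (x ∷ u) v = trans (cong (a ·₂ x ⊕_) (lincomb-++ c c' u v)) (sym (⊕-assoc (a ·₂ x) _ _))

lincomb-head : ∀ {n k} (x : Word₂ n) (v : Vec (Word₂ n) k) → lincomb (true ∷ zero₂) (x ∷ v) ≡ x
lincomb-head x v = trans (cong (x ⊕_) (lincomb-zero v)) (⊕-identityʳ x)

independent-injective : ∀ {n k} {v : Vec (Word₂ n) k} → Independent v → ∀ c c' → lincomb c v ≡ lincomb c' v → c ≡ c'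
independent-injective {v = v} ind c c' e = ⊕≡0⇒≡ (ind (c ⊕ c') (trans (lincomb-⊕ c c' v) (≡⇒⊕≡0 e)))

independent-tail : ∀ {n k} {x : Word₂ n} {v : Vec (Word₂ n) k} → Independent (x ∷ v) → Independent v
independent-tail ind c e = cong tail (ind (false ∷ c) (trans (⊕-identityˡ _) e))

independent-drop-second : ∀ {n k} {x y : Word₂ n} {v : Vec (Word₂ n) k} → Independent (x ∷ y ∷ v) → Independent (x ∷ v)
independent-drop-second {x = x} ind (a ∷ c) e = cong₂ _∷_ (cong head h) (cong (tail ∘ tail) h)
  where
  h : a ∷ false ∷ c ≡ zero₂
  h = ind (a ∷ false ∷ c) (trans (cong (a ·₂ x ⊕_) (⊕-identityˡ _)) e)

lincomb∈ : ∀ {n k} {C : Code₂ n} → IsBinaryLinear C → {v : Vec (Word₂ n) k} → All (λ x → C x ≡ true) v →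
           ∀ c → C (lincomb c v) ≡ true
lincomb∈ C-linear []           []          = IsBinaryLinear.has-zero C-linear
lincomb∈ C-linear (x∈ ∷ v∈) (true ∷ c)  = IsBinaryLinear.closed-⊕ C-linear _ _ x∈ (lincomb∈ C-linear v∈ c)
lincomb∈ C-linear (x∈ ∷ v∈) (false ∷ c) = IsBinaryLinear.closed-⊕ C-linear _ _ (IsBinaryLinear.has-zero C-linear) (lincomb∈ C-linear v∈ c)

xor-interchange : Interchangable _≡_ _xor_ _xor_
xor-interchange = CommutativeSemigroupProperties.interchange (≡-commutativeSemigroup _xor_ xor-assoc xor-comm)

dot₂-⊕ˡ : ∀ {n} (x y z : Word₂ n) → dot₂ (x ⊕ y) z ≡ dot₂ x z xor dot₂ y z
dot₂-⊕ˡ []      []      []      = refl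
dot₂-⊕ˡ (a ∷ x) (b ∷ y) (c ∷ z) =
  trans (cong₂ _xor_ (∧-distribʳ-xor c a b) (dot₂-⊕ˡ x y z)) (xor-interchange (a ∧ c) (b ∧ c) _ _)

dot₂-comm : ∀ {n} (x y : Word₂ n) → dot₂ x y ≡ dot₂ y x
dot₂-comm []      []      = refl
dot₂-comm (a ∷ x) (b ∷ y) = cong₂ _xor_ (∧-comm a b) (dot₂-comm x y)

dot₂-⊕ʳ : ∀ {n} (x y z : Word₂ n) → dot₂ x (y ⊕ z) ≡ dot₂ x y xor dot₂ x z
dot₂-⊕ʳ x y z = trans (dot₂-comm x (y ⊕ z)) (trans (dot₂-⊕ˡ y z x) (cong₂ _xor_ (dot₂-comm y x) (dot₂-comm z x)))

dot₂-zeroˡ : ∀ {n} (x : Word₂ n) → dot₂ zero₂ x ≡ false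
dot₂-zeroˡ []      = refl
dot₂-zeroˡ (a ∷ x) = dot₂-zeroˡ x

dot₂-zeroʳ : ∀ {n} (x : Word₂ n) → dot₂ x zero₂ ≡ false
dot₂-zeroʳ x = trans (dot₂-comm x zero₂) (dot₂-zeroˡ x)

dot₂-·₂ : ∀ {n} b (x y : Word₂ n) → dot₂ (b ·₂ x) y ≡ b ∧ dot₂ x y
dot₂-·₂ true  x y = refl
dot₂-·₂ false x y = dot₂-zeroˡ y

dot₂-lincomb : ∀ {n k} (c : Vec Bool k) (v : Vec (Word₂ n) k) (w : Word₂ n) →
               dot₂ (lincomb c v) w ≡ dot₂ c (map (λ x → dot₂ x w) v)
dot₂-lincomb []      []      w = dot₂-zeroˡ w
dot₂-lincomb (a ∷ c) (x ∷ v) w =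
  trans (dot₂-⊕ˡ (a ·₂ x) (lincomb c v) w) (cong₂ _xor_ (dot₂-·₂ a x w) (dot₂-lincomb c v w))

dot₂-nondegenerate : ∀ {n} (w : Word₂ n) → (∀ x → dot₂ x w ≡ false) → w ≡ zero₂
dot₂-nondegenerate []      h = refl
dot₂-nondegenerate (b ∷ w) h = cong₂ _∷_ b≡false (dot₂-nondegenerate w (h ∘ (false ∷_)))
  where
  b≡false : b ≡ false
  b≡false = trans (sym (xor-identityʳ b)) (trans (cong (b xor_) (sym (dot₂-zeroˡ w))) (h (true ∷ zero₂)))

dots : ∀ {n r} → Vec (Word₂ n) r → Word₂ n → Word₂ r
dots u x = map (λ v → dot₂ v x) u

dots-⊕ : ∀ {n r} (u : Vec (Word₂ n) r) x y → dots u (x ⊕ y) ≡ dots u x ⊕ dots u y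
dots-⊕ []      x y = refl
dots-⊕ (v ∷ u) x y = cong₂ _∷_ (dot₂-⊕ʳ v x y) (dots-⊕ u x y)

standardBasis : ∀ {n} → Vec (Word₂ n) n
standardBasis {zero}  = []
standardBasis {suc n} = (true ∷ zero₂) ∷ map (false ∷_) standardBasis

lincomb-map-false∷ : ∀ {n k} (c : Vec Bool k) (v : Vec (Word₂ n) k) → lincomb c (map (false ∷_) v) ≡ false ∷ lincomb c v
lincomb-map-false∷ []       []      = refl
lincomb-map-false∷ (true ∷ c)  (x ∷ v) = cong ((false ∷ x) ⊕_) (lincomb-map-false∷ c v)
lincomb-map-false∷ (false ∷ c) (x ∷ v) = cong (zero₂ ⊕_) (lincomb-map-false∷ c v)

lincomb-standardBasis : ∀ {n} (x : Word₂ n) → lincomb x standardBasis ≡ x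
lincomb-standardBasis []      = refl
lincomb-standardBasis (a ∷ x) =
  trans (cong (a ·₂ (true ∷ zero₂) ⊕_) (lincomb-map-false∷ x standardBasis)) (first-coordinate a)
  where
  first-coordinate : ∀ a → a ·₂ (true ∷ zero₂) ⊕ (false ∷ lincomb x standardBasis) ≡ a ∷ x
  first-coordinate true  = cong (true ∷_) (trans (⊕-identityˡ _) (lincomb-standardBasis x))
  first-coordinate false = cong (false ∷_) (trans (⊕-identityˡ _) (lincomb-standardBasis x))

lincomb-unit : ∀ {n k} (i : Fin k) (v : Vec (Word₂ n) k) → lincomb (lookup standardBasis i) v ≡ lookup v i
lincomb-unit zero    (x ∷ v) = lincomb-head x v
lincomb-unit (suc i) (x ∷ v) = trans (cong (λ l → lincomb l (x ∷ v)) (lookup-map i (false ∷_) standardBasis))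
                                     (trans (⊕-identityˡ _) (lincomb-unit i v))

basis-elements : ∀ {n k} {C : Code₂ n} {v : Vec (Word₂ n) k} → (∀ x → (C x ≡ true) ⇔ Span v x) → All (λ x → C x ≡ true) v
basis-elements {v = v} basis = All.lookup⁻ λ i → Equivalence.from (basis _) (lookup standardBasis i , lincomb-unit i v)

Linear : ∀ {m n} → (Word₂ m → Word₂ n) → Set
Linear f = ∀ x y → f (x ⊕ y) ≡ f x ⊕ f y

module _ {m n} {f : Word₂ m → Word₂ n} (f-linear : Linear f) where

  linear-zero : f zero₂ ≡ zero₂
  linear-zero = begin
    f zero₂                         ≡⟨ ⊕-cancelʳ (f zero₂) (f zero₂) ⟨
    (f zero₂ ⊕ f zero₂) ⊕ f zero₂    ≡⟨ cong (_⊕ f zero₂) (f-linear zero₂ zero₂) ⟨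
    f (zero₂ ⊕ zero₂) ⊕ f zero₂      ≡⟨ cong (λ z → f z ⊕ f zero₂) (⊕-self zero₂) ⟩
    f zero₂ ⊕ f zero₂                ≡⟨ ⊕-self (f zero₂) ⟩
    zero₂                           ∎

  linear-·₂ : ∀ b x → f (b ·₂ x) ≡ b ·₂ f x
  linear-·₂ true  x = refl
  linear-·₂ false x = linear-zero

  linear-lincomb : ∀ {k} (c : Vec Bool k) (v : Vec (Word₂ m) k) → f (lincomb c v) ≡ lincomb c (map f v)
  linear-lincomb []      []      = linear-zero
  linear-lincomb (a ∷ c) (x ∷ v) =
    trans (f-linear (a ·₂ x) (lincomb c v)) (cong₂ _⊕_ (linear-·₂ a x) (linear-lincomb c v))

  transpose : Word₂ n → Word₂ m
  transpose = dots (map f standardBasis)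

  transpose-dot : ∀ y w → dot₂ (f y) w ≡ dot₂ y (transpose w)
  transpose-dot y w = begin
    dot₂ (f y) w                                  ≡⟨ cong (λ z → dot₂ (f z) w) (lincomb-standardBasis y) ⟨
    dot₂ (f (lincomb y standardBasis)) w          ≡⟨ cong (λ z → dot₂ z w) (linear-lincomb y standardBasis) ⟩
    dot₂ (lincomb y (map f standardBasis)) w      ≡⟨ dot₂-lincomb y (map f standardBasis) w ⟩
    dot₂ y (transpose w)                          ∎

  transpose-linear : Linear transpose
  transpose-linear = dots-⊕ (map f standardBasis)

record BasisThrough {n k} (b : Vec (Word₂ n) k) (t : Word₂ n) : Set where
  field
    size        : ℕ
    suc-size    : suc size ≡ k
    rest        : Vec (Word₂ n) size
    independent : Independent (t ∷ rest)
    same-span   : ∀ x → Span b x ⇔ Span (t ∷ rest) x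

exchange-head : ∀ {n k} {p q : Word₂ n} {bs : Vec (Word₂ n) k} (l : Vec Bool k) → p ≡ q ⊕ lincomb l bs →
                ∀ a μ → a ·₂ p ⊕ lincomb μ bs ≡ a ·₂ q ⊕ lincomb (μ ⊕ a ·₂ l) bs
exchange-head {q = q} {bs = bs} l refl a μ = begin
  a ·₂ (q ⊕ lincomb l bs) ⊕ lincomb μ bs               ≡⟨ cong (_⊕ lincomb μ bs) (·₂-⊕ a q _) ⟩
  (a ·₂ q ⊕ a ·₂ lincomb l bs) ⊕ lincomb μ bs          ≡⟨ ⊕-assoc _ _ _ ⟩
  a ·₂ q ⊕ (a ·₂ lincomb l bs ⊕ lincomb μ bs)          ≡⟨ cong (a ·₂ q ⊕_) (⊕-comm _ _) ⟩
  a ·₂ q ⊕ (lincomb μ bs ⊕ a ·₂ lincomb l bs)          ≡⟨ cong (λ z → a ·₂ q ⊕ (lincomb μ bs ⊕ z)) (lincomb-·₂ a l bs) ⟨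
  a ·₂ q ⊕ (lincomb μ bs ⊕ lincomb (a ·₂ l) bs)        ≡⟨ cong (a ·₂ q ⊕_) (lincomb-⊕ μ (a ·₂ l) bs) ⟨
  a ·₂ q ⊕ lincomb (μ ⊕ a ·₂ l) bs                     ∎

basisThrough : ∀ {n k} (b : Vec (Word₂ n) k) {t : Word₂ n} → ¬ t ≡ zero₂ → Independent b → Span b t → BasisThrough b t
basisThrough [] t≢0 ind ([] , refl) = ⊥-elim (t≢0 refl)
basisThrough (b₀ ∷ bs) {t} t≢0 ind (true ∷ l , t≡) = record
  { size = _ ; suc-size = refl ; rest = bs ; independent = independent
  ; same-span = λ x → mk⇔ (swap b₀≡) (swap t≡′) }
  where
  t≡′ : t ≡ b₀ ⊕ lincomb l bs
  t≡′ = sym t≡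
  b₀≡ : b₀ ≡ t ⊕ lincomb l bs
  b₀≡ = ⊕≡⇒≡⊕ t≡
  swap : ∀ {p q x} → p ≡ q ⊕ lincomb l bs → Span (p ∷ bs) x → Span (q ∷ bs) x
  swap p≡ (a ∷ μ , refl) = a ∷ (μ ⊕ a ·₂ l) , sym (exchange-head l p≡ a μ)
  independent : Independent (t ∷ bs)
  independent (a ∷ μ) e with ind (a ∷ (μ ⊕ a ·₂ l)) (trans (sym (exchange-head l t≡′ a μ)) e)
  ... | e′ with cong head e′
  ... | refl = cong (false ∷_) (trans (sym (⊕-identityʳ μ)) (cong tail e′))
basisThrough (b₀ ∷ bs) {t} t≢0 ind (false ∷ l , t≡) = record
  { size = suc size ; suc-size = cong suc suc-size ; rest = b₀ ∷ rest ; independent = independent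
  ; same-span = λ x → mk⇔ to from }
  where
  open BasisThrough (basisThrough bs t≢0 (independent-tail ind) (l , trans (sym (⊕-identityˡ _)) t≡))
    renaming (independent to independent′)
  to : ∀ {x} → Span (b₀ ∷ bs) x → Span (t ∷ b₀ ∷ rest) x
  to (β ∷ ν , refl) with Equivalence.to (same-span _) (ν , refl)
  ... | α ∷ μ , e = α ∷ β ∷ μ , trans (⊕-swap (α ·₂ t) (β ·₂ b₀) _) (cong (β ·₂ b₀ ⊕_) e)
  from : ∀ {x} → Span (t ∷ b₀ ∷ rest) x → Span (b₀ ∷ bs) x
  from (α ∷ β ∷ μ , refl) with Equivalence.from (same-span _) (α ∷ μ , refl)
  ... | ν , e = β ∷ ν , trans (cong (β ·₂ b₀ ⊕_) e) (⊕-swap (β ·₂ b₀) (α ·₂ t) _)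
  independent : Independent (t ∷ b₀ ∷ rest)
  independent (α ∷ β ∷ μ) e = split (ind (β ∷ ν) (trans (cong (β ·₂ b₀ ⊕_) ν≡) (trans (⊕-swap _ _ _) e)))
    where
    ν : Vec Bool _
    ν = proj₁ (Equivalence.from (same-span _) (α ∷ μ , refl))
    ν≡ : lincomb ν bs ≡ α ·₂ t ⊕ lincomb μ rest
    ν≡ = proj₂ (Equivalence.from (same-span _) (α ∷ μ , refl))
    split : β ∷ ν ≡ zero₂ → α ∷ β ∷ μ ≡ zero₂
    split βν≡0 with cong head βν≡0
    ... | refl = cong (λ c → head c ∷ false ∷ tail c)
      (independent′ (α ∷ μ) (trans (sym ν≡) (trans (cong (λ c → lincomb c bs) (cong tail βν≡0)) (lincomb-zero bs))))

record Complement {N K} (d : Vec (Word₂ N) K) : Set where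
  field
    dim          : ℕ
    dim+K≡N      : dim + K ≡ N
    embed        : Word₂ dim → Word₂ N
    embed-linear : Linear embed
    decompose    : ∀ x → ∃ λ c → ∃ λ y → lincomb c d ⊕ embed y ≡ x
    direct       : ∀ c y → lincomb c d ⊕ embed y ≡ zero₂ → y ≡ zero₂

complement-single : ∀ {N} (y₀ : Word₂ N) → ¬ y₀ ≡ zero₂ → Complement (y₀ ∷ [])
complement-single []           y₀≢0 = ⊥-elim (y₀≢0 refl)
complement-single (true ∷ y)   _    = record
  { dim = _ ; dim+K≡N = +-comm _ 1 ; embed = false ∷_ ; embed-linear = λ _ _ → refl
  ; decompose = decompose ; direct = direct }
  where
  decompose : ∀ x → ∃ λ c → ∃ λ z → lincomb c ((true ∷ y) ∷ []) ⊕ (false ∷ z) ≡ x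
  decompose (true ∷ x)  = true ∷ [] , y ⊕ x , cong (true ∷_) (trans (cong (_⊕ (y ⊕ x)) (⊕-identityʳ y)) (⊕-cancelˡ y x))
  decompose (false ∷ x) = false ∷ [] , x , cong (false ∷_) (trans (cong (_⊕ x) (⊕-identityˡ zero₂)) (⊕-identityˡ x))
  direct : ∀ c z → lincomb c ((true ∷ y) ∷ []) ⊕ (false ∷ z) ≡ zero₂ → z ≡ zero₂
  direct (false ∷ []) z e = trans (sym (trans (cong (_⊕ z) (⊕-identityˡ zero₂)) (⊕-identityˡ z))) (cong tail e)
complement-single (false ∷ y) y≢0 = record
  { dim = suc dim ; dim+K≡N = cong suc dim+K≡N ; embed = embed′ ; embed-linear = linear
  ; decompose = decompose′ ; direct = direct′ }
  where
  open Complement (complement-single y (y≢0 ∘ cong (false ∷_)))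
  embed′ : Word₂ (suc dim) → Word₂ _
  embed′ (b ∷ z) = b ∷ embed z
  linear : Linear embed′
  linear (a ∷ x) (b ∷ z) = cong ((a xor b) ∷_) (embed-linear x z)
  decompose′ : ∀ x → ∃ λ c → ∃ λ z → lincomb c ((false ∷ y) ∷ []) ⊕ embed′ z ≡ x
  decompose′ (a ∷ x) with decompose x
  ... | c , z , e = c , a ∷ z , trans (cong (_⊕ (a ∷ embed z)) (lincomb-map-false∷ c (y ∷ []))) (cong (a ∷_) e)
  direct′ : ∀ c z → lincomb c ((false ∷ y) ∷ []) ⊕ embed′ z ≡ zero₂ → z ≡ zero₂
  direct′ c (b ∷ z) e = cong₂ _∷_ (cong head e′) (direct c z (cong tail e′))
    where
    e′ : b ∷ (lincomb c (y ∷ []) ⊕ embed z) ≡ zero₂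
    e′ = trans (cong (_⊕ (b ∷ embed z)) (sym (lincomb-map-false∷ c (y ∷ [])))) e

opaque
  complement : ∀ {N K} (d : Vec (Word₂ N) K) → Independent d → Complement d
  complement {N} [] _ = record
    { dim = N ; dim+K≡N = +-identityʳ N ; embed = λ y → y ; embed-linear = λ _ _ → refl
    ; decompose = λ x → [] , x , ⊕-identityˡ x ; direct = λ { [] y e → trans (sym (⊕-identityˡ y)) e } }
  complement {N} {suc K} (d₀ ∷ ds) ind = record
    { dim = Q₁.dim ; dim+K≡N = trans (+-suc Q₁.dim K) (trans (cong (_+ K) (trans (+-comm 1 Q₁.dim) Q₁.dim+K≡N)) Q.dim+K≡N)
    ; embed = Q.embed ∘ Q₁.embed
    ; embed-linear = λ y y′ → trans (cong Q.embed (Q₁.embed-linear y y′)) (Q.embed-linear _ _)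
    ; decompose = decompose ; direct = direct }
    where
    module Q = Complement (complement ds (independent-tail ind))
    a₀ : Vec Bool K
    a₀ = proj₁ (Q.decompose d₀)
    y₀ : Word₂ Q.dim
    y₀ = proj₁ (proj₂ (Q.decompose d₀))
    embed-y₀ : Q.embed y₀ ≡ d₀ ⊕ lincomb a₀ ds
    embed-y₀ = trans (sym (⊕-cancelˡ (lincomb a₀ ds) _)) (trans (cong (lincomb a₀ ds ⊕_) (proj₂ (proj₂ (Q.decompose d₀)))) (⊕-comm _ _))
    y₀≢0 : ¬ y₀ ≡ zero₂
    y₀≢0 y₀≡0 with ind (true ∷ a₀) (sym (trans (sym (linear-zero Q.embed-linear)) (trans (cong Q.embed (sym y₀≡0)) embed-y₀)))
    ... | ()
    module Q₁ = Complement (complement-single y₀ y₀≢0)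
    regroup : ∀ α a z → lincomb (α ∷ a) (d₀ ∷ ds) ⊕ Q.embed (Q₁.embed z)
                      ≡ lincomb (a ⊕ α ·₂ a₀) ds ⊕ Q.embed (lincomb (α ∷ []) (y₀ ∷ []) ⊕ Q₁.embed z)
    regroup α a z = sym (begin
      lincomb (a ⊕ α ·₂ a₀) ds ⊕ Q.embed (lincomb (α ∷ []) (y₀ ∷ []) ⊕ Q₁.embed z)
        ≡⟨ cong₂ _⊕_ (lincomb-⊕ a (α ·₂ a₀) ds) (Q.embed-linear _ _) ⟩
      (A ⊕ lincomb (α ·₂ a₀) ds) ⊕ (Q.embed (α ·₂ y₀ ⊕ zero₂) ⊕ Z)
        ≡⟨ cong₂ (λ u v → (A ⊕ u) ⊕ (v ⊕ Z)) (lincomb-·₂ α a₀ ds)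
             (trans (cong Q.embed (⊕-identityʳ _)) (trans (linear-·₂ Q.embed-linear α y₀) (cong (α ·₂_) embed-y₀))) ⟩
      (A ⊕ α ·₂ B) ⊕ (α ·₂ (d₀ ⊕ B) ⊕ Z)
        ≡⟨ cong (λ u → (A ⊕ α ·₂ B) ⊕ (u ⊕ Z)) (trans (·₂-⊕ α d₀ B) (⊕-comm _ _)) ⟩
      (A ⊕ α ·₂ B) ⊕ ((α ·₂ B ⊕ α ·₂ d₀) ⊕ Z)
        ≡⟨ cancel A (α ·₂ B) (α ·₂ d₀) Z ⟩
      (α ·₂ d₀ ⊕ A) ⊕ Z ∎)
      where
      A B Z : Word₂ N
      A = lincomb a ds
      B = lincomb a₀ ds
      Z = Q.embed (Q₁.embed z)
      cancel : ∀ {n} (A B C D : Word₂ n) → (A ⊕ B) ⊕ ((B ⊕ C) ⊕ D) ≡ (C ⊕ A) ⊕ D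
      cancel A B C D = begin
        (A ⊕ B) ⊕ ((B ⊕ C) ⊕ D)   ≡⟨ cong ((A ⊕ B) ⊕_) (⊕-assoc B C D) ⟩
        (A ⊕ B) ⊕ (B ⊕ (C ⊕ D))   ≡⟨ ⊕-assoc A B _ ⟩
        A ⊕ (B ⊕ (B ⊕ (C ⊕ D)))   ≡⟨ cong (A ⊕_) (⊕-cancelˡ B _) ⟩
        A ⊕ (C ⊕ D)               ≡⟨ ⊕-swap A C D ⟩
        C ⊕ (A ⊕ D)               ≡⟨ ⊕-assoc C A D ⟨
        (C ⊕ A) ⊕ D               ∎
    decompose : ∀ x → ∃ λ c → ∃ λ z → lincomb c (d₀ ∷ ds) ⊕ Q.embed (Q₁.embed z) ≡ x
    decompose x with Q.decompose x
    ... | a , y , ex with Q₁.decompose y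
    ... | α ∷ [] , z , ey = α ∷ (a ⊕ α ·₂ a₀) , z ,
      trans (regroup α (a ⊕ α ·₂ a₀) z) (trans (cong₂ (λ u v → lincomb u ds ⊕ Q.embed v) (⊕-cancelʳ a (α ·₂ a₀)) ey) ex)
    direct : ∀ c z → lincomb c (d₀ ∷ ds) ⊕ Q.embed (Q₁.embed z) ≡ zero₂ → z ≡ zero₂
    direct (α ∷ a) z e = Q₁.direct (α ∷ []) z (Q.direct (a ⊕ α ·₂ a₀) _ (trans (sym (regroup α a z)) e))

module _ {N K} {d : Vec (Word₂ N) K} (Q : Complement d) where
  open Complement Q

  complement-spans : ∀ x → Span (d ++ map embed standardBasis) x
  complement-spans x with decompose x
  ... | c , y , e = c ++ y , (begin
    lincomb (c ++ y) (d ++ map embed standardBasis)      ≡⟨ lincomb-++ c y d _ ⟩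
    lincomb c d ⊕ lincomb y (map embed standardBasis)     ≡⟨ cong (lincomb c d ⊕_) (linear-lincomb embed-linear y standardBasis) ⟨
    lincomb c d ⊕ embed (lincomb y standardBasis)         ≡⟨ cong (λ z → lincomb c d ⊕ embed z) (lincomb-standardBasis y) ⟩
    lincomb c d ⊕ embed y                                 ≡⟨ e ⟩
    x                                                     ∎)

  complement-dim≡0⇒spans : dim ≡ 0 → ∀ x → Span d x
  complement-dim≡0⇒spans refl x with decompose x
  ... | c , [] , e = c , trans (sym (⊕-identityʳ _)) (trans (cong (lincomb c d ⊕_) (sym (linear-zero embed-linear))) e)

injective-linear-surjective : ∀ {m m′} {f : Word₂ m → Word₂ m′} → m′ ≡ m → Linear f →
                              (∀ x → f x ≡ zero₂ → x ≡ zero₂) → ∀ y → ∃ λ x → f x ≡ y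
injective-linear-surjective {m} {f = f} m′≡m f-linear f-injective y =
  proj₁ (complement-dim≡0⇒spans Q dim≡0 y) , trans (f-lincomb _) (proj₂ (complement-dim≡0⇒spans Q dim≡0 y))
  where
  f-lincomb : ∀ c → f c ≡ lincomb c (map f standardBasis)
  f-lincomb c = trans (cong f (sym (lincomb-standardBasis c))) (linear-lincomb f-linear c standardBasis)
  Q : Complement (map f standardBasis)
  Q = complement (map f standardBasis) λ c e → f-injective c (trans (f-lincomb c) e)
  dim≡0 : Complement.dim Q ≡ 0
  dim≡0 = +-cancelʳ-≡ m _ 0 (trans (Complement.dim+K≡N Q) m′≡m)

record Parametrisation {A : Set} (P : A → Set) (e : ℕ) : Set where
  field
    point      : Word₂ e → A
    valid      : ∀ z → P (point z)
    injective  : ∀ z z′ → point z ≡ point z′ → z ≡ z′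
    surjective : ∀ x → P x → ∃ λ z → point z ≡ x

solutions : ∀ {m r} (u : Vec (Word₂ m) r) → Independent u → (a : Word₂ r) →
            ∀ e → e + r ≡ m → Parametrisation (λ x → dots u x ≡ a) e
solutions {m} {r} u ind a e e+r≡m = subst (Parametrisation _) (+-cancelʳ-≡ r dim e (trans dim+K≡N (sym e+r≡m))) record
  { point = point ; valid = valid ; injective = injective ; surjective = surjective }
  where
  open Complement (complement u ind)
  B : Vec (Word₂ m) (r + dim)
  B = u ++ map embed standardBasis
  Φ : Word₂ m → Word₂ (r + dim)
  Φ = dots B
  Φ-split : ∀ x → Φ x ≡ dots u x ++ dots (map embed standardBasis) x
  Φ-split x = map-++ (λ v → dot₂ v x) u (map embed standardBasis)
  Φ-kernel : ∀ x → Φ x ≡ zero₂ → x ≡ zero₂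
  Φ-kernel x Φx≡0 = dot₂-nondegenerate x λ y → let c , c≡ = complement-spans (complement u ind) y in begin
    dot₂ y x                 ≡⟨ cong (λ z → dot₂ z x) c≡ ⟨
    dot₂ (lincomb c B) x     ≡⟨ dot₂-lincomb c B x ⟩
    dot₂ c (Φ x)             ≡⟨ cong (dot₂ c) Φx≡0 ⟩
    dot₂ c zero₂             ≡⟨ dot₂-zeroʳ c ⟩
    false                    ∎
  Φ-injective : ∀ x y → Φ x ≡ Φ y → x ≡ y
  Φ-injective x y e = ⊕≡0⇒≡ (Φ-kernel (x ⊕ y) (trans (dots-⊕ B x y) (≡⇒⊕≡0 e)))
  Ψ : Word₂ (r + dim) → Word₂ m
  Ψ v = proj₁ (injective-linear-surjective (trans (+-comm r dim) dim+K≡N) (dots-⊕ B) Φ-kernel v)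
  ΦΨ : ∀ v → Φ (Ψ v) ≡ v
  ΦΨ v = proj₂ (injective-linear-surjective (trans (+-comm r dim) dim+K≡N) (dots-⊕ B) Φ-kernel v)
  point : Word₂ dim → Word₂ m
  point w = Ψ (a ++ w)
  valid : ∀ w → dots u (point w) ≡ a
  valid w = ++-injectiveˡ _ a (trans (sym (Φ-split (point w))) (ΦΨ (a ++ w)))
  injective : ∀ w w′ → point w ≡ point w′ → w ≡ w′
  injective w w′ e = ++-injectiveʳ a a (trans (sym (ΦΨ (a ++ w))) (trans (cong Φ e) (ΦΨ (a ++ w′))))
  surjective : ∀ x → dots u x ≡ a → ∃ λ w → point w ≡ x
  surjective x ux≡a = w , Φ-injective (point w) x (trans (ΦΨ (a ++ w)) (sym (trans (Φ-split x) (cong (_++ w) ux≡a))))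
    where
    w : Word₂ dim
    w = dots (map embed standardBasis) x

module _ {A : Set} {P Q : A → Set} where

  Parametrisation-⇔ : ∀ {e} → (∀ x → P x → Q x) → (∀ x → Q x → P x) → Parametrisation P e → Parametrisation Q e
  Parametrisation-⇔ P⇒Q Q⇒P 𝒫 = record
    { point = point ; valid = λ z → P⇒Q _ (valid z) ; injective = injective ; surjective = λ x → surjective x ∘ Q⇒P x }
    where open Parametrisation 𝒫

parametrise-∷ : ∀ {A : Set} {j a b} {P : Vec A j → Set} {R : Vec A j → A → Set} →
                Parametrisation P a → (∀ ys → Parametrisation (R ys) b) →
                Parametrisation (λ v → P (tail v) × R (tail v) (head v)) (a + b)
parametrise-∷ {A} {a = a} {P = P} {R} 𝒫 ℛ = record
  { point = point ; valid = valid ; injective = injective ; surjective = surjective }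
  where
  module 𝒫 = Parametrisation 𝒫
  module ℛ ys = Parametrisation (ℛ ys)
  point : Word₂ (a + _) → Vec A _
  point z = ℛ.point (𝒫.point (take a z)) (drop a z) ∷ 𝒫.point (take a z)
  valid : ∀ z → P (tail (point z)) × R (tail (point z)) (head (point z))
  valid z = 𝒫.valid (take a z) , ℛ.valid _ (drop a z)
  injective : ∀ z z′ → point z ≡ point z′ → z ≡ z′
  injective z z′ e = begin
    z                            ≡⟨ take++drop≡id a z ⟨
    take a z ++ drop a z         ≡⟨ cong₂ _++_ take≡ (drop≡ take≡ (cong head e)) ⟩
    take a z′ ++ drop a z′       ≡⟨ take++drop≡id a z′ ⟩
    z′                           ∎
    where
    take≡ : take a z ≡ take a z′
    take≡ = 𝒫.injective _ _ (cong tail e)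
    drop≡ : ∀ {t t′} → t ≡ t′ → ℛ.point (𝒫.point t) (drop a z) ≡ ℛ.point (𝒫.point t′) (drop a z′) → drop a z ≡ drop a z′
    drop≡ refl = ℛ.injective _ _ _
  surjective : ∀ v → P (tail v) × R (tail v) (head v) → ∃ λ z → point z ≡ v
  surjective (y ∷ ys) (Pys , Ryys) with 𝒫.surjective ys Pys
  ... | t , refl with ℛ.surjective (𝒫.point t) y Ryys
  ... | w , refl = t ++ w , cong₂ (λ t′ w′ → ℛ.point (𝒫.point t′) w′ ∷ 𝒫.point t′) take≡ drop≡
    where
    take≡ : take a (t ++ w) ≡ t
    take≡ = ++-injectiveˡ _ t (take++drop≡id a (t ++ w))
    drop≡ : drop a (t ++ w) ≡ w
    drop≡ = ++-injectiveʳ (take a (t ++ w)) t (take++drop≡id a (t ++ w))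

lift : ∀ {n} → Word₂ n → Word₂ n → Word₄ n
lift = zipWith lift₄

high : ∀ {n} → Word₄ n → Word₂ n
high = map high₂

module _ {n : ℕ} where

  +ᵥ-assoc : ∀ (x y z : Word₄ n) → (x +ᵥ y) +ᵥ z ≡ x +ᵥ (y +ᵥ z)
  +ᵥ-assoc = zipWith-assoc +₄-assoc

  +ᵥ-comm : ∀ (x y : Word₄ n) → x +ᵥ y ≡ y +ᵥ x
  +ᵥ-comm = zipWith-comm +₄-comm

  +ᵥ-identityˡ : ∀ (x : Word₄ n) → zero₄ +ᵥ x ≡ x
  +ᵥ-identityˡ = zipWith-identityˡ +₄-identityˡ

  +ᵥ-identityʳ : ∀ (x : Word₄ n) → x +ᵥ zero₄ ≡ x
  +ᵥ-identityʳ = zipWith-identityʳ +₄-identityʳ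

  +ᵥ-interchange : ∀ (w x y z : Word₄ n) → (w +ᵥ x) +ᵥ (y +ᵥ z) ≡ (w +ᵥ y) +ᵥ (x +ᵥ z)
  +ᵥ-interchange = CommutativeSemigroupProperties.interchange (≡-commutativeSemigroup _+ᵥ_ +ᵥ-assoc +ᵥ-comm)

+ᵥ-swap : ∀ {n} (x y z : Word₄ n) → x +ᵥ (y +ᵥ z) ≡ y +ᵥ (x +ᵥ z)
+ᵥ-swap = CommutativeSemigroupProperties.x∙yz≈y∙xz (≡-commutativeSemigroup _+ᵥ_ +ᵥ-assoc +ᵥ-comm)

π-+ᵥ : ∀ {n} (x y : Word₄ n) → π (x +ᵥ y) ≡ π x ⊕ π y
π-+ᵥ []      []      = refl
π-+ᵥ (a ∷ x) (b ∷ y) = cong₂ _∷_ (π₂-+₄ a b) (π-+ᵥ x y)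

lift-π-high : ∀ {n} (x : Word₄ n) → lift (π x) (high x) ≡ x
lift-π-high []      = refl
lift-π-high (a ∷ x) = cong₂ _∷_ (lift₄-π₂-high₂ a) (lift-π-high x)

π-lift : ∀ {n} (c m : Word₂ n) → π (lift c m) ≡ c
π-lift []      []      = refl
π-lift (a ∷ c) (b ∷ m) = cong₂ _∷_ (π₂-lift₄ a b) (π-lift c m)

high-lift : ∀ {n} (c m : Word₂ n) → high (lift c m) ≡ m
high-lift []      []      = refl
high-lift (a ∷ c) (b ∷ m) = cong₂ _∷_ (high₂-lift₄ a b) (high-lift c m)

lift-zero : ∀ {n} (m : Word₂ n) → lift zero₂ m ≡ ι m
lift-zero []      = refl
lift-zero (b ∷ m) = cong (ι₄ b ∷_) (lift-zero m)

lift-+ᵥ-ι : ∀ {n} (c m a : Word₂ n) → lift c m +ᵥ ι a ≡ lift c (m ⊕ a)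
lift-+ᵥ-ι []      []      []      = refl
lift-+ᵥ-ι (x ∷ c) (y ∷ m) (z ∷ a) = cong₂ _∷_ (lift₄-+₄-ι₄ x y z) (lift-+ᵥ-ι c m a)

lift-+ᵥ-lift : ∀ {n} (c m m′ : Word₂ n) → lift c m +ᵥ lift c m′ ≡ ι ((m ⊕ m′) ⊕ c)
lift-+ᵥ-lift []      []      []        = refl
lift-+ᵥ-lift (a ∷ c) (b ∷ m) (b′ ∷ m′) = cong₂ _∷_ (lift₄-+₄-lift₄ a b b′) (lift-+ᵥ-lift c m m′)

π-ι : ∀ {n} (a : Word₂ n) → π (ι a) ≡ zero₂
π-ι a = trans (cong π (sym (lift-zero a))) (π-lift zero₂ a)

high-ι : ∀ {n} (a : Word₂ n) → high (ι a) ≡ a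
high-ι a = trans (cong high (sym (lift-zero a))) (high-lift zero₂ a)

ι-zero : ∀ {n} → ι {n} zero₂ ≡ zero₄
ι-zero {zero}  = refl
ι-zero {suc n} = cong (z0 ∷_) ι-zero

ι-⊕ : ∀ {n} (a b : Word₂ n) → ι (a ⊕ b) ≡ ι a +ᵥ ι b
ι-⊕ a b = begin
  ι (a ⊕ b)              ≡⟨ lift-zero (a ⊕ b) ⟨
  lift zero₂ (a ⊕ b)     ≡⟨ lift-+ᵥ-ι zero₂ a b ⟨
  lift zero₂ a +ᵥ ι b    ≡⟨ cong (_+ᵥ ι b) (lift-zero a) ⟩
  ι a +ᵥ ι b             ∎

π-+ᵥ-ι : ∀ {n} (y : Word₄ n) a → π (y +ᵥ ι a) ≡ π y
π-+ᵥ-ι y a = trans (π-+ᵥ y (ι a)) (trans (cong (π y ⊕_) (π-ι a)) (⊕-identityʳ (π y)))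

high-+ᵥ-ι : ∀ {n} (y : Word₄ n) a → high (y +ᵥ ι a) ≡ high y ⊕ a
high-+ᵥ-ι y a = begin
  high (y +ᵥ ι a)                          ≡⟨ cong (λ z → high (z +ᵥ ι a)) (lift-π-high y) ⟨
  high (lift (π y) (high y) +ᵥ ι a)        ≡⟨ cong high (lift-+ᵥ-ι (π y) (high y) a) ⟩
  high (lift (π y) (high y ⊕ a))           ≡⟨ high-lift (π y) _ ⟩
  high y ⊕ a                               ∎

π≡⇒≡+ᵥι : ∀ {n} (x y : Word₄ n) → π x ≡ π y → x ≡ y +ᵥ ι (high y ⊕ high x)
π≡⇒≡+ᵥι x y e = begin
  x                                          ≡⟨ lift-π-high x ⟨
  lift (π x) (high x)                        ≡⟨ cong₂ lift e (sym (⊕-cancelˡ (high y) (high x))) ⟩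
  lift (π y) (high y ⊕ (high y ⊕ high x))    ≡⟨ lift-+ᵥ-ι (π y) (high y) _ ⟨
  lift (π y) (high y) +ᵥ ι (high y ⊕ high x) ≡⟨ cong (_+ᵥ ι (high y ⊕ high x)) (lift-π-high y) ⟩
  y +ᵥ ι (high y ⊕ high x)                   ∎

+ᵥ-self : ∀ {n} (x : Word₄ n) → x +ᵥ x ≡ ι (π x)
+ᵥ-self x = begin
  x +ᵥ x                                                 ≡⟨ cong₂ _+ᵥ_ (lift-π-high x) (lift-π-high x) ⟨
  lift (π x) (high x) +ᵥ lift (π x) (high x)             ≡⟨ lift-+ᵥ-lift (π x) (high x) (high x) ⟩
  ι ((high x ⊕ high x) ⊕ π x)                            ≡⟨ cong (λ z → ι (z ⊕ π x)) (⊕-self (high x)) ⟩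
  ι (zero₂ ⊕ π x)                                        ≡⟨ cong ι (⊕-identityˡ (π x)) ⟩
  ι (π x)                                                ∎

infixr 8 _×ᵥ_
_×ᵥ_ : ∀ {n} → ℕ → Word₄ n → Word₄ n
zero  ×ᵥ x = zero₄
suc k ×ᵥ x = x +ᵥ (k ×ᵥ x)

·ᵥ-as-×ᵥ : ∀ {n} a (x : Word₄ n) → a ·ᵥ x ≡ toℕ₄ a ×ᵥ x
·ᵥ-as-×ᵥ a []      = ×ᵥ-[] (toℕ₄ a)
  where
  ×ᵥ-[] : ∀ k → [] ≡ k ×ᵥ []
  ×ᵥ-[] zero    = refl
  ×ᵥ-[] (suc k) = cong ([] +ᵥ_) (×ᵥ-[] k)
·ᵥ-as-×ᵥ a (b ∷ x) = trans (cong₂ _∷_ (*₄-as-× a b) (·ᵥ-as-×ᵥ a x)) (×ᵥ-∷ (toℕ₄ a))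
  where
  ×ᵥ-∷ : ∀ k → (k ×₄ b) ∷ (k ×ᵥ x) ≡ k ×ᵥ (b ∷ x)
  ×ᵥ-∷ zero    = refl
  ×ᵥ-∷ (suc k) = cong ((b ∷ x) +ᵥ_) (×ᵥ-∷ k)

+ᵥ-·ᵥ-z3 : ∀ {n} (x : Word₄ n) → x +ᵥ (z3 ·ᵥ x) ≡ zero₄
+ᵥ-·ᵥ-z3 []      = refl
+ᵥ-·ᵥ-z3 (a ∷ x) = cong₂ _∷_ (+₄-*₄-z3 a) (+ᵥ-·ᵥ-z3 x)

dot₄ : ∀ {n} → Word₄ n → Word₄ n → ℤ₄
dot₄ x y = foldr _ _+₄_ z0 (zipWith _*₄_ x y)

dot₄-+ᵥˡ : ∀ {n} (x y z : Word₄ n) → dot₄ (x +ᵥ y) z ≡ dot₄ x z +₄ dot₄ y z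
dot₄-+ᵥˡ []      []      []      = refl
dot₄-+ᵥˡ (a ∷ x) (b ∷ y) (c ∷ z) =
  trans (cong₂ _+₄_ (*₄-distribʳ-+₄ a b c) (dot₄-+ᵥˡ x y z)) (+₄-interchange (a *₄ c) (b *₄ c) _ _)

dot₄-comm : ∀ {n} (x y : Word₄ n) → dot₄ x y ≡ dot₄ y x
dot₄-comm []      []      = refl
dot₄-comm (a ∷ x) (b ∷ y) = cong₂ _+₄_ (*₄-comm a b) (dot₄-comm x y)

dot₄-+ᵥʳ : ∀ {n} (x y z : Word₄ n) → dot₄ x (y +ᵥ z) ≡ dot₄ x y +₄ dot₄ x z
dot₄-+ᵥʳ x y z = trans (dot₄-comm x _) (trans (dot₄-+ᵥˡ y z x) (cong₂ _+₄_ (dot₄-comm y x) (dot₄-comm z x)))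

dot₄-zeroˡ : ∀ {n} (y : Word₄ n) → dot₄ zero₄ y ≡ z0
dot₄-zeroˡ []      = refl
dot₄-zeroˡ (a ∷ y) = trans (cong₂ _+₄_ (*₄-zeroˡ a) (dot₄-zeroˡ y)) refl

dot₄-zeroʳ : ∀ {n} (y : Word₄ n) → dot₄ y zero₄ ≡ z0
dot₄-zeroʳ y = trans (dot₄-comm y zero₄) (dot₄-zeroˡ y)

π₂-dot₄ : ∀ {n} (x y : Word₄ n) → π₂ (dot₄ x y) ≡ dot₂ (π x) (π y)
π₂-dot₄ []      []      = refl
π₂-dot₄ (a ∷ x) (b ∷ y) = trans (π₂-+₄ (a *₄ b) (dot₄ x y)) (cong₂ _xor_ (π₂-*₄ a b) (π₂-dot₄ x y))

dot₄-ι : ∀ {n} (a : Word₂ n) (y : Word₄ n) → dot₄ (ι a) y ≡ ι₄ (dot₂ a (π y))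
dot₄-ι []      []      = refl
dot₄-ι (p ∷ a) (q ∷ y) = begin
  (ι₄ p *₄ q) +₄ dot₄ (ι a) y                     ≡⟨ cong₂ _+₄_ (ι₄-*₄ p q) (dot₄-ι a y) ⟩
  ι₄ (p ∧ π₂ q) +₄ ι₄ (dot₂ a (π y))              ≡⟨ lift₄-+₄-ι₄ false (p ∧ π₂ q) _ ⟩
  ι₄ ((p ∧ π₂ q) xor dot₂ a (π y))                ∎

dot₄-lift : ∀ {n} (c m c′ m′ : Word₂ n) →
            dot₄ (lift c m) (lift c′ m′) ≡ dot₄ (lift c zero₂) (lift c′ zero₂) +₄ ι₄ (dot₂ m c′ xor dot₂ c m′)
dot₄-lift []      []      []        []        = refl
dot₄-lift (a ∷ c) (b ∷ m) (a′ ∷ c′) (b′ ∷ m′) = begin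
  (lift₄ a b *₄ lift₄ a′ b′) +₄ dot₄ (lift c m) (lift c′ m′)
    ≡⟨ cong₂ _+₄_ (lift₄-*₄ a b a′ b′) (dot₄-lift c m c′ m′) ⟩
  (A +₄ ι₄ ((b ∧ a′) xor (a ∧ b′))) +₄ (B +₄ ι₄ (dot₂ m c′ xor dot₂ c m′))
    ≡⟨ +₄-interchange A _ B _ ⟩
  (A +₄ B) +₄ (ι₄ ((b ∧ a′) xor (a ∧ b′)) +₄ ι₄ (dot₂ m c′ xor dot₂ c m′))
    ≡⟨ cong ((A +₄ B) +₄_) (lift₄-+₄-ι₄ false ((b ∧ a′) xor (a ∧ b′)) (dot₂ m c′ xor dot₂ c m′)) ⟩
  (A +₄ B) +₄ ι₄ (((b ∧ a′) xor (a ∧ b′)) xor (dot₂ m c′ xor dot₂ c m′))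
    ≡⟨ cong (λ z → (A +₄ B) +₄ ι₄ z) (xor-interchange (b ∧ a′) (a ∧ b′) _ _) ⟩
  (A +₄ B) +₄ ι₄ (((b ∧ a′) xor dot₂ m c′) xor ((a ∧ b′) xor dot₂ c m′)) ∎
  where
  A B : ℤ₄
  A = lift₄ a false *₄ lift₄ a′ false
  B = dot₄ (lift c zero₂) (lift c′ zero₂)

wtE₈ : ∀ {n} → Word₄ n → ℤ₈
wtE₈ x = [ wtE x ]₈

wtE₈-∷ : ∀ {n} a (x : Word₄ n) → wtE₈ (a ∷ x) ≡ wt₈ a +₈ wtE₈ x
wtE₈-∷ a x = []₈-+ (wtE₄ a) (wtE x)

wtE₈-zero : ∀ {n} → wtE₈ (zero₄ {n}) ≡ [ 0 ]₈
wtE₈-zero {n} = cong [_]₈ (wtE-zero n)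
  where
  wtE-zero : ∀ n → wtE (zero₄ {n}) ≡ 0
  wtE-zero zero    = refl
  wtE-zero (suc n) = wtE-zero n

wtE₈-+ᵥ : ∀ {n} (x y : Word₄ n) → wtE₈ (x +ᵥ y) ≡ (wtE₈ x +₈ wtE₈ y) +₈ double₈ (dot₄ x y)
wtE₈-+ᵥ []      []      = refl
wtE₈-+ᵥ (a ∷ x) (b ∷ y) = begin
  wtE₈ ((a +₄ b) ∷ (x +ᵥ y))
    ≡⟨ wtE₈-∷ (a +₄ b) (x +ᵥ y) ⟩
  wt₈ (a +₄ b) +₈ wtE₈ (x +ᵥ y)
    ≡⟨ cong₂ _+₈_ (wt₈-+₄ a b) (wtE₈-+ᵥ x y) ⟩
  ((wt₈ a +₈ wt₈ b) +₈ double₈ (a *₄ b)) +₈ ((wtE₈ x +₈ wtE₈ y) +₈ double₈ (dot₄ x y))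
    ≡⟨ +₈-interchange (wt₈ a +₈ wt₈ b) _ (wtE₈ x +₈ wtE₈ y) _ ⟩
  ((wt₈ a +₈ wt₈ b) +₈ (wtE₈ x +₈ wtE₈ y)) +₈ (double₈ (a *₄ b) +₈ double₈ (dot₄ x y))
    ≡⟨ cong₂ _+₈_ (+₈-interchange (wt₈ a) (wt₈ b) (wtE₈ x) (wtE₈ y)) (sym (double₈-+₄ (a *₄ b) (dot₄ x y))) ⟩
  ((wt₈ a +₈ wtE₈ x) +₈ (wt₈ b +₈ wtE₈ y)) +₈ double₈ ((a *₄ b) +₄ dot₄ x y)
    ≡⟨ cong (λ z → z +₈ double₈ ((a *₄ b) +₄ dot₄ x y)) (cong₂ _+₈_ (wtE₈-∷ a x) (wtE₈-∷ b y)) ⟨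
  (wtE₈ (a ∷ x) +₈ wtE₈ (b ∷ y)) +₈ double₈ (dot₄ (a ∷ x) (b ∷ y)) ∎

wtE₈-ι : ∀ {n} (a : Word₂ n) → wtE₈ (ι a) ≡ four₈ (dot₂ a one₂)
wtE₈-ι []      = refl
wtE₈-ι (b ∷ a) = begin
  wtE₈ (ι₄ b ∷ ι a)                        ≡⟨ wtE₈-∷ (ι₄ b) (ι a) ⟩
  wt₈ (ι₄ b) +₈ wtE₈ (ι a)                 ≡⟨ cong₂ _+₈_ (wt₈-ι₄ b) (wtE₈-ι a) ⟩
  four₈ b +₈ four₈ (dot₂ a one₂)           ≡⟨ four₈-xor b (dot₂ a one₂) ⟨
  four₈ (b xor dot₂ a one₂)                ≡⟨ cong (λ z → four₈ (z xor dot₂ a one₂)) (∧-identityʳ b) ⟨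
  four₈ ((b ∧ true) xor dot₂ a one₂)       ∎

wtE₈-lift : ∀ {n} (c m : Word₂ n) → wtE₈ (lift c m) ≡ [ wtH c ]₈ +₈ four₈ (dot₂ m (map not c))
wtE₈-lift []      []      = refl
wtE₈-lift (a ∷ c) (b ∷ m) = begin
  wtE₈ (lift₄ a b ∷ lift c m)
    ≡⟨ wtE₈-∷ (lift₄ a b) (lift c m) ⟩
  wt₈ (lift₄ a b) +₈ wtE₈ (lift c m)
    ≡⟨ cong₂ _+₈_ (wt₈-lift₄ a b) (wtE₈-lift c m) ⟩
  ([ if a then 1 else 0 ]₈ +₈ four₈ (b ∧ not a)) +₈ ([ wtH c ]₈ +₈ four₈ (dot₂ m (map not c)))
    ≡⟨ +₈-interchange [ if a then 1 else 0 ]₈ _ _ _ ⟩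
  ([ if a then 1 else 0 ]₈ +₈ [ wtH c ]₈) +₈ (four₈ (b ∧ not a) +₈ four₈ (dot₂ m (map not c)))
    ≡⟨ cong₂ _+₈_ ([]₈-+ (if a then 1 else 0) (wtH c)) (four₈-xor (b ∧ not a) _) ⟨
  [ wtH (a ∷ c) ]₈ +₈ four₈ (dot₂ (b ∷ m) (map not (a ∷ c))) ∎

bit : Bool → Fin 2
bit true  = zero
bit false = suc zero

unbit : Fin 2 → Bool
unbit zero        = true
unbit (suc zero) = false

toFin : ∀ e → Word₂ e → Fin (2 ^ e)
toFin zero    []      = zero
toFin (suc e) (b ∷ w) = combine (bit b) (toFin e w)

fromFin : ∀ e → Fin (2 ^ e) → Word₂ e
fromFin zero    _ = []
fromFin (suc e) i = uncurry (λ q r → unbit q ∷ fromFin e r) (remQuot {2} (2 ^ e) i)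

fromFin-toFin : ∀ e (w : Word₂ e) → fromFin e (toFin e w) ≡ w
fromFin-toFin zero    []      = refl
fromFin-toFin (suc e) (b ∷ w) =
  trans (cong (uncurry (λ q r → unbit q ∷ fromFin e r)) (remQuot-combine (bit b) (toFin e w)))
        (cong₂ _∷_ (unbit-bit b) (fromFin-toFin e w))
  where
  unbit-bit : ∀ b → unbit (bit b) ≡ b
  unbit-bit true  = refl
  unbit-bit false = refl

toFin-fromFin : ∀ e (i : Fin (2 ^ e)) → toFin e (fromFin e i) ≡ i
toFin-fromFin zero    zero = refl
toFin-fromFin (suc e) i     = trans (cong₂ combine (bit-unbit q) (toFin-fromFin e r)) (combine-remQuot {2} (2 ^ e) i)
  where
  q : Fin 2
  q = proj₁ (remQuot {2} (2 ^ e) i)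
  r : Fin (2 ^ e)
  r = proj₂ (remQuot {2} (2 ^ e) i)
  bit-unbit : ∀ j → bit (unbit j) ≡ j
  bit-unbit zero        = refl
  bit-unbit (suc zero) = refl

count-by-parametrisation : ∀ {n e} {P : Code₄ n → Set} (code : Word₂ e → Code₄ n) →
                           (∀ z → P (code z)) → (∀ z z′ → SameCode₄ (code z) (code z′) → z ≡ z′) →
                           (∀ C → P C → ∃ λ z → SameCode₄ C (code z)) → NumberOfCodes₄ P (2 ^ e)
count-by-parametrisation {e = e} {P} code valid distinct complete = codes , valid′ , distinct′ , complete′
  where
  codes : Vec (Code₄ _) (2 ^ e)
  codes = tabulate (code ∘ fromFin e)
  lookup-codes : ∀ i → lookup codes i ≡ code (fromFin e i)
  lookup-codes = lookup∘tabulate _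
  valid′ : ∀ i → P (lookup codes i)
  valid′ i = subst P (sym (lookup-codes i)) (valid (fromFin e i))
  distinct′ : ∀ i j → SameCode₄ (lookup codes i) (lookup codes j) → i ≡ j
  distinct′ i j same = begin
    i                           ≡⟨ toFin-fromFin e i ⟨
    toFin e (fromFin e i)       ≡⟨ cong (toFin e) (distinct _ _ λ x → trans (cong (λ C → C x) (sym (lookup-codes i))) (trans (same x) (cong (λ C → C x) (lookup-codes j)))) ⟩
    toFin e (fromFin e j)       ≡⟨ toFin-fromFin e j ⟩
    j                           ∎
  complete′ : ∀ C → P C → ∃ λ i → SameCode₄ C (lookup codes i)
  complete′ C PC with complete C PC
  ... | z , same = toFin e z , λ x →
    trans (same x) (trans (cong (λ w → code w x) (sym (fromFin-toFin e z))) (cong (λ D → D x) (sym (lookup-codes (toFin e z)))))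

-- Codes generated by lifts

lincomb₄ : ∀ {n k} → Vec Bool k → Vec (Word₄ n) k → Word₄ n
lincomb₄ []          []       = zero₄
lincomb₄ (true ∷ l)  (g ∷ gs) = g +ᵥ lincomb₄ l gs
lincomb₄ (false ∷ l) (g ∷ gs) = lincomb₄ l gs

lincomb₄-zero : ∀ {n k} (gs : Vec (Word₄ n) k) → lincomb₄ zero₂ gs ≡ zero₄
lincomb₄-zero []       = refl
lincomb₄-zero (g ∷ gs) = lincomb₄-zero gs

lincomb₄-unit : ∀ {n k} (i : Fin k) (gs : Vec (Word₄ n) k) → lincomb₄ (lookup standardBasis i) gs ≡ lookup gs i
lincomb₄-unit zero    (g ∷ gs) = trans (cong (g +ᵥ_) (lincomb₄-zero gs)) (+ᵥ-identityʳ g)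
lincomb₄-unit (suc i) (g ∷ gs) = trans (cong (λ l → lincomb₄ l (g ∷ gs)) (Vec.lookup-map i (false ∷_) standardBasis))
                                       (lincomb₄-unit i gs)

π-lincomb₄ : ∀ {n k} (l : Vec Bool k) (gs : Vec (Word₄ n) k) → π (lincomb₄ l gs) ≡ lincomb l (map π gs)
π-lincomb₄ []          []       = trans (cong π (sym ι-zero)) (π-ι zero₂)
π-lincomb₄ (true ∷ l)  (g ∷ gs) = trans (π-+ᵥ g _) (cong (π g ⊕_) (π-lincomb₄ l gs))
π-lincomb₄ (false ∷ l) (g ∷ gs) = trans (π-lincomb₄ l gs) (sym (⊕-identityˡ _))

≡true⇔⇒≡ : ∀ {a b} → (a ≡ true → b ≡ true) → (b ≡ true → a ≡ true) → a ≡ b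
≡true⇔⇒≡ {true}  {true}  _ _ = refl
≡true⇔⇒≡ {true}  {false} f _ = sym (f refl)
≡true⇔⇒≡ {false} {true}  _ g = g refl
≡true⇔⇒≡ {false} {false} _ _ = refl

EvenSelfOrthogonal : ∀ {n k} → Vec (Word₄ n) k → Set
EvenSelfOrthogonal gs = All (λ g → wtE₈ g ≡ [ 0 ]₈) gs × AllPairs (λ g h → dot₄ g h ≡ z0) gs

dot₄-lincomb₄ : ∀ {n k} (g : Word₄ n) {hs : Vec (Word₄ n) k} → All (λ h → dot₄ g h ≡ z0) hs →
                ∀ l → dot₄ g (lincomb₄ l hs) ≡ z0
dot₄-lincomb₄ g []           []          = dot₄-zeroʳ g
dot₄-lincomb₄ g (g⊥h ∷ g⊥hs) (true ∷ l)  = trans (dot₄-+ᵥʳ g _ _) (cong₂ _+₄_ g⊥h (dot₄-lincomb₄ g g⊥hs l))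
dot₄-lincomb₄ g (_ ∷ g⊥hs)   (false ∷ l) = dot₄-lincomb₄ g g⊥hs l

wtE₈-lincomb₄ : ∀ {n k} (gs : Vec (Word₄ n) k) → EvenSelfOrthogonal gs → ∀ l → wtE₈ (lincomb₄ l gs) ≡ [ 0 ]₈
wtE₈-lincomb₄ {n} []   _                                  []          = wtE₈-zero {n}
wtE₈-lincomb₄ (g ∷ gs) (g-even ∷ gs-even , g⊥gs ∷ gs-orth) (true ∷ l)  = begin
  wtE₈ (g +ᵥ lincomb₄ l gs)                                              ≡⟨ wtE₈-+ᵥ g _ ⟩
  (wtE₈ g +₈ wtE₈ (lincomb₄ l gs)) +₈ double₈ (dot₄ g (lincomb₄ l gs))   ≡⟨ cong₂ (λ u v → (wtE₈ g +₈ u) +₈ double₈ v) (wtE₈-lincomb₄ gs (gs-even , gs-orth) l) (dot₄-lincomb₄ g g⊥gs l) ⟩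
  (wtE₈ g +₈ [ 0 ]₈) +₈ double₈ z0                                       ≡⟨ cong (λ u → (u +₈ [ 0 ]₈) +₈ double₈ z0) g-even ⟩
  [ 0 ]₈                                                                 ∎
wtE₈-lincomb₄ (g ∷ gs) (_ ∷ gs-even , _ ∷ gs-orth)        (false ∷ l) = wtE₈-lincomb₄ gs (gs-even , gs-orth) l

even-orthogonal : ∀ {n} (x y : Word₄ n) → wtE₈ x ≡ [ 0 ]₈ → wtE₈ y ≡ [ 0 ]₈ → wtE₈ (x +ᵥ y) ≡ [ 0 ]₈ → dot₄ x y ≡ z0
even-orthogonal x y x-even y-even x+y-even = double₈≡0⇒≡z0 (dot₄ x y) (begin
  double₈ (dot₄ x y)                                    ≡⟨ +₈-identityˡ _ ⟨
  [ 0 ]₈ +₈ double₈ (dot₄ x y)                          ≡⟨ cong (λ u → u +₈ double₈ (dot₄ x y)) (cong₂ _+₈_ x-even y-even) ⟨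
  (wtE₈ x +₈ wtE₈ y) +₈ double₈ (dot₄ x y)              ≡⟨ wtE₈-+ᵥ x y ⟨
  wtE₈ (x +ᵥ y)                                         ≡⟨ x+y-even ⟩
  [ 0 ]₈                                                ∎)

even-code-evenSelfOrthogonal : ∀ {n k} {C : Code₄ n} → IsQuaternaryCode C → EvenCode₄ C →
                               ∀ {gs : Vec (Word₄ n) k} → All (λ g → C g ≡ true) gs → EvenSelfOrthogonal gs
even-code-evenSelfOrthogonal {C = C} C-code C-even gs∈ = All.map even gs∈ , orthogonal gs∈
  where
  open IsQuaternaryCode C-code
  even : ∀ {g} → C g ≡ true → wtE₈ g ≡ [ 0 ]₈
  even g∈ = Equivalence.from ([]₈≡0⇔8∣ _) (C-even _ g∈)
  orthogonal : ∀ {j} {hs : Vec (Word₄ _) j} → All (λ g → C g ≡ true) hs → AllPairs (λ g h → dot₄ g h ≡ z0) hs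
  orthogonal []                    = []
  orthogonal {hs = h ∷ _} (h∈ ∷ hs∈) =
    All.map (λ {h′} h′∈ → even-orthogonal h h′ (even h∈) (even h′∈) (even (closed-+ h h′ h∈ h′∈))) hs∈ ∷ orthogonal hs∈

module Generated {n : ℕ} (C₂ : Code₂ n) (C₂-linear : IsBinaryLinear C₂) where
  open IsBinaryLinear C₂-linear renaming (has-zero to C₂-zero; closed-⊕ to C₂-⊕)

  infix 4 _∼_ _∼?_
  _∼_ : Word₄ n → Word₄ n → Set
  x ∼ y = ∃ λ a → C₂ a ≡ true × x ≡ y +ᵥ ι a

  ∼-refl : ∀ {x} → x ∼ x
  ∼-refl {x} = zero₂ , C₂-zero , sym (trans (cong (x +ᵥ_) ι-zero) (+ᵥ-identityʳ x))

  ∼-trans : ∀ {x y z} → x ∼ y → y ∼ z → x ∼ z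
  ∼-trans {z = z} (a , a∈ , refl) (b , b∈ , refl) =
    b ⊕ a , C₂-⊕ b a b∈ a∈ , trans (+ᵥ-assoc z (ι b) (ι a)) (cong (z +ᵥ_) (sym (ι-⊕ b a)))

  ∼-+ᵥ : ∀ {x y x′ y′} → x ∼ y → x′ ∼ y′ → x +ᵥ x′ ∼ y +ᵥ y′
  ∼-+ᵥ {y = y} {y′ = y′} (a , a∈ , refl) (b , b∈ , refl) =
    a ⊕ b , C₂-⊕ a b a∈ b∈ , trans (+ᵥ-interchange y (ι a) y′ (ι b)) (cong ((y +ᵥ y′) +ᵥ_) (sym (ι-⊕ a b)))

  ≡⇒∼ : ∀ {x y} → x ≡ y → x ∼ y
  ≡⇒∼ refl = ∼-refl

  _∼?_ : ∀ x y → Dec (x ∼ y)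
  x ∼? y = map′ sound complete ((Vec.≡-dec Bool._≟_ (π x) (π y)) ×-dec (C₂ (high y ⊕ high x) Bool.≟ true))
    where
    sound : π x ≡ π y × C₂ (high y ⊕ high x) ≡ true → x ∼ y
    sound (π≡ , ∈C₂) = high y ⊕ high x , ∈C₂ , π≡⇒≡+ᵥι x y π≡
    complete : x ∼ y → π x ≡ π y × C₂ (high y ⊕ high x) ≡ true
    complete (a , a∈ , refl) = π-+ᵥ-ι y a , subst (λ b → C₂ b ≡ true) (sym (trans (cong (high y ⊕_) (high-+ᵥ-ι y a)) (⊕-cancelˡ (high y) a))) a∈

  -- the code spanned by gs and ι(C₂); when 2g = ι(π g) ∈ ι(C₂) for each generator g, its words are
  -- exactly those congruent to a 0/1-combination of gs
  generated : ∀ {k} → Vec (Word₄ n) k → Code₄ n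
  generated gs x = does (anySubset? λ l → x ∼? lincomb₄ l gs)

  generated-sound : ∀ {k} (gs : Vec (Word₄ n) k) {x} → generated gs x ≡ true → ∃ λ l → x ∼ lincomb₄ l gs
  generated-sound gs {x} e with anySubset? (λ l → x ∼? lincomb₄ l gs) | e
  ... | yes p | _ = p

  generated-complete : ∀ {k} (gs : Vec (Word₄ n) k) {x} l → x ∼ lincomb₄ l gs → generated gs x ≡ true
  generated-complete gs l x∼ = dec-true (anySubset? _) (l , x∼)

  lincomb₄∈generated : ∀ {k} (gs : Vec (Word₄ n) k) l → generated gs (lincomb₄ l gs) ≡ true
  lincomb₄∈generated gs l = generated-complete gs l ∼-refl

  lincomb₄-+ᵥ : ∀ {k} (l l′ : Vec Bool k) {gs : Vec (Word₄ n) k} → All (λ g → C₂ (π g) ≡ true) gs →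
                lincomb₄ l gs +ᵥ lincomb₄ l′ gs ∼ lincomb₄ (l ⊕ l′) gs
  lincomb₄-+ᵥ []          []            []            = ≡⇒∼ (+ᵥ-identityˡ zero₄)
  lincomb₄-+ᵥ (true ∷ l)  (true ∷ l′)  {g ∷ gs} (g∈ ∷ gs∈) =
    ∼-trans (≡⇒∼ (+ᵥ-interchange g _ g _)) (∼-trans (∼-+ᵥ twice (lincomb₄-+ᵥ l l′ gs∈)) (≡⇒∼ (+ᵥ-identityˡ _)))
    where
    twice : g +ᵥ g ∼ zero₄
    twice = π g , g∈ , trans (+ᵥ-self g) (sym (+ᵥ-identityˡ _))
  lincomb₄-+ᵥ (true ∷ l)  (false ∷ l′) {g ∷ gs} (_ ∷ gs∈) =
    ∼-trans (≡⇒∼ (+ᵥ-assoc g _ _)) (∼-+ᵥ ∼-refl (lincomb₄-+ᵥ l l′ gs∈))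
  lincomb₄-+ᵥ (false ∷ l) (true ∷ l′)  {g ∷ gs} (_ ∷ gs∈) =
    ∼-trans (≡⇒∼ (+ᵥ-swap _ g _)) (∼-+ᵥ ∼-refl (lincomb₄-+ᵥ l l′ gs∈))
  lincomb₄-+ᵥ (false ∷ l) (false ∷ l′) {g ∷ gs} (_ ∷ gs∈) = lincomb₄-+ᵥ l l′ gs∈

  module Properties {k} {C₁ : Code₂ n} (gs : Vec (Word₄ n) k)
           (residues-basis : ∀ x → (C₁ x ≡ true) ⇔ Span (map π gs) x)
           (residues-independent : Independent (map π gs))
           (C₁⊆C₂ : C₁ ⊆₂ C₂) where

    π-lincomb₄∈C₁ : ∀ l → C₁ (π (lincomb₄ l gs)) ≡ true
    π-lincomb₄∈C₁ l = Equivalence.from (residues-basis _) (l , sym (π-lincomb₄ l gs))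

    π-lookup : ∀ i → π (lookup gs i) ≡ lincomb (lookup standardBasis i) (map π gs)
    π-lookup i = sym (trans (lincomb-unit i (map π gs)) (Vec.lookup-map i π gs))

    generators-π∈C₂ : All (λ g → C₂ (π g) ≡ true) gs
    generators-π∈C₂ = All.lookup⁻ λ i → C₁⊆C₂ _ (subst (λ y → C₁ y ≡ true) (cong π (lincomb₄-unit i gs))
                                                      (π-lincomb₄∈C₁ (lookup standardBasis i)))

    generator∈generated : ∀ i → generated gs (lookup gs i) ≡ true
    generator∈generated i = generated-complete gs (lookup standardBasis i) (≡⇒∼ (sym (lincomb₄-unit i gs)))

    ∼-lincomb₄⇒π≡ : ∀ {x} l → x ∼ lincomb₄ l gs → π x ≡ lincomb l (map π gs)
    ∼-lincomb₄⇒π≡ l (a , _ , refl) = trans (π-+ᵥ-ι _ a) (π-lincomb₄ l gs)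

    ∼-generator : ∀ i {x} → generated gs x ≡ true → π x ≡ π (lookup gs i) → x ∼ lookup gs i
    ∼-generator i {x} x∈ π≡ with generated-sound gs x∈
    ... | l , x∼ = subst (x ∼_) (trans (cong (λ l′ → lincomb₄ l′ gs) l≡) (lincomb₄-unit i gs)) x∼
      where
      l≡ : l ≡ lookup standardBasis i
      l≡ = independent-injective residues-independent _ _ (trans (sym (∼-lincomb₄⇒π≡ l x∼)) (trans π≡ (π-lookup i)))

    generated-isQuaternaryCode : IsQuaternaryCode (generated gs)
    generated-isQuaternaryCode = record { has-zero = has-zero ; closed-+ = closed-+ ; closed-· = closed-· }
      where
      has-zero : generated gs zero₄ ≡ true
      has-zero = subst (λ x → generated gs x ≡ true) (lincomb₄-zero gs) (lincomb₄∈generated gs zero₂)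
      closed-+ : ∀ x y → generated gs x ≡ true → generated gs y ≡ true → generated gs (x +ᵥ y) ≡ true
      closed-+ x y x∈ y∈ with generated-sound gs x∈ | generated-sound gs y∈
      ... | l , x∼ | l′ , y∼ = generated-complete gs (l ⊕ l′) (∼-trans (∼-+ᵥ x∼ y∼) (lincomb₄-+ᵥ l l′ generators-π∈C₂))
      closed-× : ∀ m x → generated gs x ≡ true → generated gs (m ×ᵥ x) ≡ true
      closed-× zero    x x∈ = has-zero
      closed-× (suc m) x x∈ = closed-+ x _ x∈ (closed-× m x x∈)
      closed-· : ∀ a x → generated gs x ≡ true → generated gs (a ·ᵥ x) ≡ true
      closed-· a x x∈ = subst (λ y → generated gs y ≡ true) (sym (·ᵥ-as-×ᵥ a x)) (closed-× (toℕ₄ a) x x∈)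

    generated-residue : ResidueIs (generated gs) C₁
    generated-residue y = mk⇔ to from
      where
      to : C₁ y ≡ true → ∃ λ x → generated gs x ≡ true × π x ≡ y
      to y∈ with Equivalence.to (residues-basis y) y∈
      ... | l , refl = lincomb₄ l gs , lincomb₄∈generated gs l , π-lincomb₄ l gs
      from : (∃ λ x → generated gs x ≡ true × π x ≡ y) → C₁ y ≡ true
      from (x , x∈ , refl) with generated-sound gs x∈
      ... | l , x∼ = Equivalence.from (residues-basis _) (l , sym (∼-lincomb₄⇒π≡ l x∼))

    generated-torsion : TorsionIs (generated gs) C₂
    generated-torsion y = mk⇔ to from
      where
      to : C₂ y ≡ true → generated gs (ι y) ≡ true
      to y∈ = generated-complete gs zero₂ (y , y∈ , trans (sym (+ᵥ-identityˡ (ι y))) (cong (_+ᵥ ι y) (sym (lincomb₄-zero gs))))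
      from : generated gs (ι y) ≡ true → C₂ y ≡ true
      from ιy∈ with generated-sound gs ιy∈
      ... | l , x∼@(a , a∈ , ιy≡) = subst (λ b → C₂ b ≡ true) (sym y≡a) a∈
        where
        l≡0 : l ≡ zero₂
        l≡0 = residues-independent l (trans (sym (∼-lincomb₄⇒π≡ l x∼)) (π-ι y))
        y≡a : y ≡ a
        y≡a = begin
          y                              ≡⟨ high-ι y ⟨
          high (ι y)                     ≡⟨ cong high ιy≡ ⟩
          high (lincomb₄ l gs +ᵥ ι a)    ≡⟨ cong (λ l′ → high (lincomb₄ l′ gs +ᵥ ι a)) l≡0 ⟩
          high (lincomb₄ zero₂ gs +ᵥ ι a) ≡⟨ cong (λ z → high (z +ᵥ ι a)) (lincomb₄-zero gs) ⟩
          high (zero₄ +ᵥ ι a)            ≡⟨ cong high (+ᵥ-identityˡ (ι a)) ⟩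
          high (ι a)                     ≡⟨ high-ι a ⟩
          a                              ∎

    generated-unique : ∀ C → IsQuaternaryCode C → ResidueIs C C₁ → TorsionIs C C₂ →
                       All (λ g → C g ≡ true) gs → SameCode₄ C (generated gs)
    generated-unique C C-code C-residue C-torsion gs∈C x = ≡true⇔⇒≡ to from
      where
      open IsQuaternaryCode C-code
      lincomb₄∈C : ∀ {j} l {hs : Vec (Word₄ n) j} → All (λ g → C g ≡ true) hs → C (lincomb₄ l hs) ≡ true
      lincomb₄∈C []          []           = has-zero
      lincomb₄∈C (true ∷ l)  (h∈ ∷ hs∈)  = closed-+ _ _ h∈ (lincomb₄∈C l hs∈)
      lincomb₄∈C (false ∷ l) (_ ∷ hs∈)   = lincomb₄∈C l hs∈
      from : generated gs x ≡ true → C x ≡ true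
      from x∈ with generated-sound gs x∈
      ... | l , a , a∈ , refl = closed-+ _ _ (lincomb₄∈C l gs∈C) (Equivalence.to (C-torsion a) a∈)
      to : C x ≡ true → generated gs x ≡ true
      to x∈ with Equivalence.to (residues-basis (π x)) (Equivalence.from (C-residue (π x)) (x , x∈ , refl))
      ... | l , πL≡πx = generated-complete gs l (e , e∈C₂ , x≡)
        where
        L : Word₄ n
        L = lincomb₄ l gs
        e : Word₂ n
        e = high L ⊕ high x
        x≡ : x ≡ L +ᵥ ι e
        x≡ = π≡⇒≡+ᵥι x L (trans (sym πL≡πx) (sym (π-lincomb₄ l gs)))
        ιe≡ : x +ᵥ (z3 ·ᵥ L) ≡ ι e
        ιe≡ = begin
          x +ᵥ (z3 ·ᵥ L)               ≡⟨ cong (_+ᵥ (z3 ·ᵥ L)) x≡ ⟩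
          (L +ᵥ ι e) +ᵥ (z3 ·ᵥ L)      ≡⟨ cong (_+ᵥ (z3 ·ᵥ L)) (+ᵥ-comm L (ι e)) ⟩
          (ι e +ᵥ L) +ᵥ (z3 ·ᵥ L)      ≡⟨ +ᵥ-assoc (ι e) L _ ⟩
          ι e +ᵥ (L +ᵥ (z3 ·ᵥ L))      ≡⟨ cong (ι e +ᵥ_) (+ᵥ-·ᵥ-z3 L) ⟩
          ι e +ᵥ zero₄                 ≡⟨ +ᵥ-identityʳ (ι e) ⟩
          ι e                          ∎
        e∈C₂ : C₂ e ≡ true
        e∈C₂ = Equivalence.from (C-torsion e)
          (subst (λ z → C z ≡ true) ιe≡ (closed-+ _ _ x∈ (closed-· z3 L (lincomb₄∈C l gs∈C))))

    generated-even : (∀ a → C₂ a ≡ true → a ∈⊥ C₁) → C₁ one₂ ≡ true → EvenSelfOrthogonal gs → EvenCode₄ (generated gs)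
    generated-even C₂⊥C₁ one∈C₁ gs-even x x∈ with generated-sound gs x∈
    ... | l , a , a∈ , refl = Equivalence.to ([]₈≡0⇔8∣ _) (begin
      wtE₈ (L +ᵥ ι a)                                      ≡⟨ wtE₈-+ᵥ L (ι a) ⟩
      (wtE₈ L +₈ wtE₈ (ι a)) +₈ double₈ (dot₄ L (ι a))      ≡⟨ cong₂ (λ u v → (u +₈ wtE₈ (ι a)) +₈ double₈ v) (wtE₈-lincomb₄ gs gs-even l) dot≡0 ⟩
      ([ 0 ]₈ +₈ wtE₈ (ι a)) +₈ double₈ z0                 ≡⟨ cong (λ u → ([ 0 ]₈ +₈ u) +₈ double₈ z0) (wtE₈-ι a) ⟩
      ([ 0 ]₈ +₈ four₈ (dot₂ a one₂)) +₈ double₈ z0        ≡⟨ cong (λ b → ([ 0 ]₈ +₈ four₈ b) +₈ double₈ z0) (trans (dot₂-comm a one₂) (C₂⊥C₁ a a∈ one₂ one∈C₁)) ⟩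
      [ 0 ]₈                                                ∎)
      where
      L : Word₄ n
      L = lincomb₄ l gs
      dot≡0 : dot₄ L (ι a) ≡ z0
      dot≡0 = begin
        dot₄ L (ι a)               ≡⟨ dot₄-comm L (ι a) ⟩
        dot₄ (ι a) L               ≡⟨ dot₄-ι a L ⟩
        ι₄ (dot₂ a (π L))          ≡⟨ cong ι₄ (trans (dot₂-comm a (π L)) (C₂⊥C₁ a a∈ (π L) (π-lincomb₄∈C₁ l))) ⟩
        z0                         ∎

-- Evenness of lifts as linear conditions

xor-rotate : ∀ p q r → p xor (q xor r) ≡ false ⇔ q ≡ p xor r
xor-rotate p q r = mk⇔
  (from-yes (allBool? λ p → allBool? λ q → allBool? λ r → (p xor (q xor r) Bool.≟ false) →-dec (q Bool.≟ p xor r)) p q r)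
  (from-yes (allBool? λ p → allBool? λ q → allBool? λ r → (q Bool.≟ p xor r) →-dec (p xor (q xor r) Bool.≟ false)) p q r)

π₂≡false⇒≡ι₄ : ∀ a → π₂ a ≡ false → a ≡ ι₄ (high₂ a)
π₂≡false⇒≡ι₄ a e = trans (sym (lift₄-π₂-high₂ a)) (cong (λ c → lift₄ c (high₂ a)) e)

dot₄-lift≡z0⇔ : ∀ {n} (c m c′ m′ : Word₂ n) → dot₂ c c′ ≡ false →
                dot₄ (lift c m) (lift c′ m′) ≡ z0 ⇔ dot₂ c′ m ≡ high₂ (dot₄ (lift c zero₂) (lift c′ zero₂)) xor dot₂ c m′
dot₄-lift≡z0⇔ c m c′ m′ c⊥c′ = mk⇔
  (λ e → trans (dot₂-comm c′ m) (Equivalence.to (xor-rotate (high₂ B) (dot₂ m c′) (dot₂ c m′)) (ι₄-injective (trans (sym dot≡) e))))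
  (λ e → trans dot≡ (cong ι₄ (Equivalence.from (xor-rotate (high₂ B) (dot₂ m c′) (dot₂ c m′)) (trans (dot₂-comm m c′) e))))
  where
  B : ℤ₄
  B = dot₄ (lift c zero₂) (lift c′ zero₂)
  π₂B≡false : π₂ B ≡ false
  π₂B≡false = trans (π₂-dot₄ (lift c zero₂) (lift c′ zero₂)) (trans (cong₂ dot₂ (π-lift c zero₂) (π-lift c′ zero₂)) c⊥c′)
  dot≡ : dot₄ (lift c m) (lift c′ m′) ≡ ι₄ (high₂ B xor (dot₂ m c′ xor dot₂ c m′))
  dot≡ = begin
    dot₄ (lift c m) (lift c′ m′)                        ≡⟨ dot₄-lift c m c′ m′ ⟩
    B +₄ ι₄ (dot₂ m c′ xor dot₂ c m′)                   ≡⟨ cong (_+₄ ι₄ (dot₂ m c′ xor dot₂ c m′)) (π₂≡false⇒≡ι₄ B π₂B≡false) ⟩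
    ι₄ (high₂ B) +₄ ι₄ (dot₂ m c′ xor dot₂ c m′)        ≡⟨ lift₄-+₄-ι₄ false (high₂ B) _ ⟩
    ι₄ (high₂ B xor (dot₂ m c′ xor dot₂ c m′))          ∎

wtE₈-lift≡0⇔ : ∀ {n} (c m : Word₂ n) → 4 ∣ wtH c → wtE₈ (lift c m) ≡ [ 0 ]₈ ⇔ dot₂ m (map not c) ≡ is4₈ [ wtH c ]₈
wtE₈-lift≡0⇔ c m 4∣wtc = mk⇔
  (λ e → Equivalence.to (four₈-cancel _ _) (trans (sym wt≡) e))
  (λ e → trans wt≡ (Equivalence.from (four₈-cancel _ _) e))
  where
  wt≡ : wtE₈ (lift c m) ≡ four₈ (is4₈ [ wtH c ]₈) +₈ four₈ (dot₂ m (map not c))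
  wt≡ = trans (wtE₈-lift c m) (cong (_+₈ four₈ (dot₂ m (map not c))) (4∣⇒≡four₈ (wtH c) 4∣wtc))

xor-solve : ∀ p q w → p xor q ≡ w ⇔ q ≡ w xor p
xor-solve p q w = mk⇔
  (from-yes (allBool? λ p → allBool? λ q → allBool? λ w → (p xor q Bool.≟ w) →-dec (q Bool.≟ w xor p)) p q w)
  (from-yes (allBool? λ p → allBool? λ q → allBool? λ w → (q Bool.≟ w xor p) →-dec (p xor q Bool.≟ w)) p q w)

map-not : ∀ {n} (c : Word₂ n) → map not c ≡ one₂ ⊕ c
map-not []      = refl
map-not (a ∷ c) = cong (not a ∷_) (map-not c)

∷≡∷⇔ : ∀ {A : Set} {n} {x y : A} {xs ys : Vec A n} → x ∷ xs ≡ y ∷ ys ⇔ (x ≡ y × xs ≡ ys)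
∷≡∷⇔ = mk⇔ (λ { refl → refl , refl }) (λ { (refl , refl) → refl })

module Lifts {n : ℕ} (C₁ : Code₂ n) (C₁-selfOrthogonal : ∀ x y → C₁ x ≡ true → C₁ y ≡ true → dot₂ x y ≡ false)
             (C₁-doublyEven : DoublyEven C₁) (one∈C₁ : C₁ one₂ ≡ true) where

  g₀ : Word₄ n
  g₀ = lift one₂ zero₂

  β : Word₂ n → Word₂ n → Bool
  β c c′ = high₂ (dot₄ (lift c zero₂) (lift c′ zero₂))

  -- the conditions on m making lift c m orthogonal to g₀ and to the later generators, and even
  rowTarget : ∀ {j} → Word₂ n → Vec (Word₂ n) j → Vec (Word₂ n) j → Word₂ (suc (suc j))
  rowTarget c cs ms = β c one₂ ∷ (is4₈ [ wtH c ]₈ xor β c one₂) ∷ zipWith (λ c′ m′ → β c c′ xor dot₂ c m′) cs ms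

  EvenRow : ∀ {j} → Word₄ n → Vec (Word₄ n) j → Set
  EvenRow g gs = dot₄ g₀ g ≡ z0 × wtE₈ g ≡ [ 0 ]₈ × All (λ h → dot₄ g h ≡ z0) gs

  orthogonal-later⇔ : ∀ {j} c m (cs ms : Vec (Word₂ n) j) → C₁ c ≡ true → All (λ c′ → C₁ c′ ≡ true) cs →
    dots cs m ≡ zipWith (λ c′ m′ → β c c′ xor dot₂ c m′) cs ms ⇔ All (λ h → dot₄ (lift c m) h ≡ z0) (zipWith lift cs ms)
  orthogonal-later⇔ c m []        []        _   _ = mk⇔ (λ _ → []) (λ _ → refl)
  orthogonal-later⇔ c m (c′ ∷ cs) (m′ ∷ ms) c∈ (c′∈ ∷ cs∈) = mk⇔
    (λ e → let e₁ , e₂ = Equivalence.to ∷≡∷⇔ e in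
           Equivalence.from orthogonal⇔ e₁ ∷ Equivalence.to (orthogonal-later⇔ c m cs ms c∈ cs∈) e₂)
    (λ { (h ∷ hs) → Equivalence.from ∷≡∷⇔ (Equivalence.to orthogonal⇔ h , Equivalence.from (orthogonal-later⇔ c m cs ms c∈ cs∈) hs) })
    where
    orthogonal⇔ : dot₄ (lift c m) (lift c′ m′) ≡ z0 ⇔ dot₂ c′ m ≡ β c c′ xor dot₂ c m′
    orthogonal⇔ = dot₄-lift≡z0⇔ c m c′ m′ (C₁-selfOrthogonal c c′ c∈ c′∈)

  row⇔ : ∀ {j} c m (cs ms : Vec (Word₂ n) j) → C₁ c ≡ true → All (λ c′ → C₁ c′ ≡ true) cs →
         dots (one₂ ∷ c ∷ cs) m ≡ rowTarget c cs ms ⇔ EvenRow (lift c m) (zipWith lift cs ms)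
  row⇔ c m cs ms c∈ cs∈ = mk⇔ to from
    where
    a ω : Bool
    a = β c one₂
    ω = is4₈ [ wtH c ]₈
    orthogonal-g₀⇔ : dot₂ one₂ m ≡ a ⇔ dot₄ g₀ (lift c m) ≡ z0
    orthogonal-g₀⇔ = mk⇔
      (λ e → trans (dot₄-comm g₀ _) (Equivalence.from orthogonal⇔ (trans e (sym a-xor-0))))
      (λ e → trans (Equivalence.to orthogonal⇔ (trans (dot₄-comm (lift c m) g₀) e)) a-xor-0)
      where
      orthogonal⇔ : dot₄ (lift c m) g₀ ≡ z0 ⇔ dot₂ one₂ m ≡ a xor dot₂ c zero₂
      orthogonal⇔ = dot₄-lift≡z0⇔ c m one₂ zero₂ (C₁-selfOrthogonal c one₂ c∈ one∈C₁)
      a-xor-0 : a xor dot₂ c zero₂ ≡ a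
      a-xor-0 = trans (cong (a xor_) (dot₂-zeroʳ c)) (xor-identityʳ a)
    not-c : dot₂ m (map not c) ≡ dot₂ one₂ m xor dot₂ c m
    not-c = trans (cong (dot₂ m) (map-not c)) (trans (dot₂-⊕ʳ m one₂ c) (cong₂ _xor_ (dot₂-comm m one₂) (dot₂-comm m c)))
    even⇔ : dot₂ one₂ m ≡ a → dot₂ c m ≡ ω xor a ⇔ wtE₈ (lift c m) ≡ [ 0 ]₈
    even⇔ e₁ = mk⇔
      (λ e → Equivalence.from (wtE₈-lift≡0⇔ c m (C₁-doublyEven c c∈))
               (trans not-c (Equivalence.from (xor-solve (dot₂ one₂ m) (dot₂ c m) ω) (trans e (cong (ω xor_) (sym e₁))))))
      (λ e → trans (Equivalence.to (xor-solve (dot₂ one₂ m) (dot₂ c m) ω)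
               (trans (sym not-c) (Equivalence.to (wtE₈-lift≡0⇔ c m (C₁-doublyEven c c∈)) e))) (cong (ω xor_) e₁))
    to : dots (one₂ ∷ c ∷ cs) m ≡ rowTarget c cs ms → EvenRow (lift c m) (zipWith lift cs ms)
    to e with Equivalence.to ∷≡∷⇔ e
    ... | e₁ , e′ with Equivalence.to ∷≡∷⇔ e′
    ... | e₂ , e₃ = Equivalence.to orthogonal-g₀⇔ e₁ , Equivalence.to (even⇔ e₁) e₂ ,
                    Equivalence.to (orthogonal-later⇔ c m cs ms c∈ cs∈) e₃
    from : EvenRow (lift c m) (zipWith lift cs ms) → dots (one₂ ∷ c ∷ cs) m ≡ rowTarget c cs ms
    from (h₁ , h₂ , h₃) = Equivalence.from ∷≡∷⇔ (e₁ , Equivalence.from ∷≡∷⇔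
      (Equivalence.from (even⇔ e₁) h₂ , Equivalence.from (orthogonal-later⇔ c m cs ms c∈ cs∈) h₃))
      where
      e₁ : dot₂ one₂ m ≡ a
      e₁ = Equivalence.from orthogonal-g₀⇔ h₁

  AdmissibleLifts : ∀ {j} → Vec (Word₂ n) j → Vec (Word₂ n) j → Set
  AdmissibleLifts cs ms = All (λ g → dot₄ g₀ g ≡ z0) (zipWith lift cs ms) × EvenSelfOrthogonal (zipWith lift cs ms)

  ValidLifts : ∀ {j} → Vec (Word₂ n) j → Vec (Word₂ n) j → Set
  ValidLifts []       []       = ⊤
  ValidLifts (c ∷ cs) (m ∷ ms) = ValidLifts cs ms × dots (one₂ ∷ c ∷ cs) m ≡ rowTarget c cs ms

  validLifts⇔ : ∀ {j} (cs ms : Vec (Word₂ n) j) → All (λ c → C₁ c ≡ true) cs → ValidLifts cs ms ⇔ AdmissibleLifts cs ms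
  validLifts⇔ []       []       _            = mk⇔ (λ _ → [] , [] , []) (λ _ → tt)
  validLifts⇔ (c ∷ cs) (m ∷ ms) (c∈ ∷ cs∈) = mk⇔ to from
    where
    later : ValidLifts cs ms ⇔ AdmissibleLifts cs ms
    later = validLifts⇔ cs ms cs∈
    row : dots (one₂ ∷ c ∷ cs) m ≡ rowTarget c cs ms ⇔ EvenRow (lift c m) (zipWith lift cs ms)
    row = row⇔ c m cs ms c∈ cs∈
    to : ValidLifts (c ∷ cs) (m ∷ ms) → AdmissibleLifts (c ∷ cs) (m ∷ ms)
    to (valid , r) with Equivalence.to later valid | Equivalence.to row r
    ... | g₀⊥ , evens , pairs | h₁ , h₂ , h₃ = h₁ ∷ g₀⊥ , h₂ ∷ evens , h₃ ∷ pairs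
    from : AdmissibleLifts (c ∷ cs) (m ∷ ms) → ValidLifts (c ∷ cs) (m ∷ ms)
    from (h₁ ∷ g₀⊥ , h₂ ∷ evens , h₃ ∷ pairs) = Equivalence.from later (g₀⊥ , evens , pairs) , Equivalence.from row (h₁ , h₂ , h₃)

triangular : ℕ → ℕ → ℕ
triangular zero    R = 0
triangular (suc j) R = triangular j (suc R) + R

module Classification {n : ℕ} (8∣n : 8 ∣ n) (C₁ C₂ : Code₂ n) (C₁-linear : IsBinaryLinear C₁) (C₂-linear : IsBinaryLinear C₂)
  (C₁⊆C₂ : C₁ ⊆₂ C₂) (C₂⊥C₁ : ∀ y → C₂ y ≡ true → y ∈⊥ C₁) (C₁-doublyEven : DoublyEven C₁) (one∈C₁ : C₁ one₂ ≡ true)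
  {k} (cs : Vec (Word₂ n) k) (C₁-basis : ∀ x → (C₁ x ≡ true) ⇔ Span (one₂ ∷ cs) x) (basis-independent : Independent (one₂ ∷ cs))
  {K} (d : Vec (Word₂ n) K) (C₂-basis : ∀ x → (C₂ x ≡ true) ⇔ Span d x) (d-independent : Independent d) where

  C₁-selfOrthogonal : ∀ x y → C₁ x ≡ true → C₁ y ≡ true → dot₂ x y ≡ false
  C₁-selfOrthogonal x y x∈ y∈ = C₂⊥C₁ y (C₁⊆C₂ y y∈) x x∈

  open Lifts C₁ C₁-selfOrthogonal C₁-doublyEven one∈C₁
  open Complement (complement d d-independent) renaming (dim to M; embed to s; embed-linear to s-linear)
  open Generated C₂ C₂-linear

  M+K≡n : M + K ≡ n
  M+K≡n = dim+K≡N

  sᵀ : Word₂ n → Word₂ M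
  sᵀ = transpose s-linear

  dots-sᵀ : ∀ {j} (v : Vec (Word₂ n) j) y → dots (map sᵀ v) y ≡ dots v (s y)
  dots-sᵀ []      y = refl
  dots-sᵀ (x ∷ v) y = cong₂ _∷_ (trans (dot₂-comm (sᵀ x) y) (trans (sym (transpose-dot s-linear y x)) (dot₂-comm (s y) x))) (dots-sᵀ v y)

  -- a vector of C₁ orthogonal to the image of s is orthogonal to everything, as C₁ ⊥ C₂ = Span d
  sᵀ-independent : ∀ {j} {v : Vec (Word₂ n) j} → All (λ x → C₁ x ≡ true) v → Independent v → Independent (map sᵀ v)
  sᵀ-independent {v = v} v∈ v-independent c sᵀ-comb≡0 = v-independent c (dot₂-nondegenerate w w⊥)
    where
    w : Word₂ n
    w = lincomb c v
    w⊥ : ∀ x → dot₂ x w ≡ false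
    w⊥ x with decompose x
    ... | a , y , refl = begin
      dot₂ (lincomb a d ⊕ s y) w              ≡⟨ dot₂-⊕ˡ (lincomb a d) (s y) w ⟩
      dot₂ (lincomb a d) w xor dot₂ (s y) w   ≡⟨ cong₂ _xor_ (trans (dot₂-comm _ w) (C₂⊥C₁ _ (Equivalence.from (C₂-basis _) (a , refl)) w (lincomb∈ C₁-linear v∈ c)))
                                                            (transpose-dot s-linear y w) ⟩
      false xor dot₂ y (sᵀ w)                  ≡⟨ cong (dot₂ y) (trans (linear-lincomb (transpose-linear s-linear) c v) sᵀ-comb≡0) ⟩
      dot₂ y zero₂                            ≡⟨ dot₂-zeroʳ y ⟩
      false                                   ∎

  parametrise-lifts : ∀ {j} (cs′ : Vec (Word₂ n) j) → Independent (one₂ ∷ cs′) → All (λ c → C₁ c ≡ true) cs′ →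
                      ∀ R → R + suc j ≡ M → Parametrisation (λ ys → ValidLifts cs′ (map s ys)) (triangular j R)
  parametrise-lifts []         _ _            R _     = record
    { point = λ _ → [] ; valid = λ _ → tt ; injective = λ { [] [] _ → refl } ; surjective = λ { [] _ → [] , refl } }
  parametrise-lifts (c ∷ cs′) ind (c∈ ∷ cs′∈) R R+j≡M =
    Parametrisation-⇔ (λ { (_ ∷ _) h → h }) (λ { (_ ∷ _) h → h })
      (parametrise-∷ (parametrise-lifts cs′ (independent-drop-second ind) cs′∈ (suc R) (trans (sym (+-suc R _)) R+j≡M)) row)
    where
    row : ∀ ys → Parametrisation (λ y → dots (one₂ ∷ c ∷ cs′) (s y) ≡ rowTarget c cs′ (map s ys)) R
    row ys = Parametrisation-⇔ (λ y e → trans (sym (dots-sᵀ _ y)) e) (λ y e → trans (dots-sᵀ _ y) e)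
      (solutions (map sᵀ (one₂ ∷ c ∷ cs′)) (sᵀ-independent (one∈C₁ ∷ c∈ ∷ cs′∈) ind) (rowTarget c cs′ (map s ys)) R R+j≡M)

  cs∈C₁ : All (λ c → C₁ c ≡ true) cs
  cs∈C₁ with basis-elements C₁-basis
  ... | _ ∷ cs∈ = cs∈

  generators : Vec (Word₂ M) k → Vec (Word₄ n) (suc k)
  generators ys = g₀ ∷ zipWith lift cs (map s ys)

  π-generators : ∀ ys → map π (generators ys) ≡ one₂ ∷ cs
  π-generators ys = cong₂ _∷_ (π-lift one₂ zero₂) (π-zipWith-lift cs (map s ys))
    where
    π-zipWith-lift : ∀ {j} (cs′ ms : Vec (Word₂ n) j) → map π (zipWith lift cs′ ms) ≡ cs′
    π-zipWith-lift []        []       = refl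
    π-zipWith-lift (c ∷ cs′) (m ∷ ms) = cong₂ _∷_ (π-lift c m) (π-zipWith-lift cs′ ms)

  residues-basis : ∀ ys x → (C₁ x ≡ true) ⇔ Span (map π (generators ys)) x
  residues-basis ys x = subst (λ v → (C₁ x ≡ true) ⇔ Span v x) (sym (π-generators ys)) (C₁-basis x)

  residues-independent : ∀ ys → Independent (map π (generators ys))
  residues-independent ys = subst Independent (sym (π-generators ys)) basis-independent

  module Generators ys = Properties (generators ys) (residues-basis ys) (residues-independent ys) C₁⊆C₂

  code : Vec (Word₂ M) k → Code₄ n
  code ys = generated (generators ys)

  Classified : Code₄ n → Set
  Classified C = IsQuaternaryCode C × EvenCode₄ C × C one₄ ≡ true × ResidueIs C C₁ × TorsionIs C C₂

  g₀≡one₄ : g₀ ≡ one₄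
  g₀≡one₄ = lift-one n
    where
    lift-one : ∀ m → lift (one₂ {m}) zero₂ ≡ one₄
    lift-one zero    = refl
    lift-one (suc m) = cong (z1 ∷_) (lift-one m)

  g₀-even : wtE₈ g₀ ≡ [ 0 ]₈
  g₀-even = trans (cong wtE₈ g₀≡one₄) (trans (cong [_]₈ (wtE-one n)) (Equivalence.from ([]₈≡0⇔8∣ n) 8∣n))
    where
    wtE-one : ∀ m → wtE (one₄ {m}) ≡ m
    wtE-one zero    = refl
    wtE-one (suc m) = cong suc (wtE-one m)

  code-classified : ∀ ys → ValidLifts cs (map s ys) → Classified (code ys)
  code-classified ys valid with Equivalence.to (validLifts⇔ cs (map s ys) cs∈C₁) valid
  ... | g₀⊥ , evens , pairs =
    generated-isQuaternaryCode ,
    generated-even C₂⊥C₁ one∈C₁ (g₀-even ∷ evens , g₀⊥ ∷ pairs) ,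
    subst (λ g → code ys g ≡ true) g₀≡one₄ (generator∈generated zero) ,
    generated-residue ,
    generated-torsion
    where open Generators ys

  -- two lifts of c congruent modulo ι(C₂) have equal high parts modulo C₂ = Span d, so their s-parts agree
  lift-determined : ∀ c y y′ → lift c (s y′) ∼ lift c (s y) → y ≡ y′
  lift-determined c y y′ (a , a∈ , e) with Equivalence.to (C₂-basis a) a∈
  ... | α , refl = ⊕≡0⇒≡ (direct α (y ⊕ y′) (begin
    lincomb α d ⊕ s (y ⊕ y′)                 ≡⟨ cong (lincomb α d ⊕_) (s-linear y y′) ⟩
    lincomb α d ⊕ (s y ⊕ s y′)               ≡⟨ cong (λ z → lincomb α d ⊕ (s y ⊕ z)) s-parts ⟩
    lincomb α d ⊕ (s y ⊕ (s y ⊕ lincomb α d)) ≡⟨ cong (lincomb α d ⊕_) (⊕-cancelˡ (s y) _) ⟩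
    lincomb α d ⊕ lincomb α d                ≡⟨ ⊕-self _ ⟩
    zero₂                                    ∎))
    where
    s-parts : s y′ ≡ s y ⊕ lincomb α d
    s-parts = trans (sym (high-lift c (s y′))) (trans (cong high (trans e (lift-+ᵥ-ι c (s y) _))) (high-lift c _))

  lookup-generators : ∀ ys i → lookup (generators ys) (suc i) ≡ lift (lookup cs i) (s (lookup ys i))
  lookup-generators ys i = trans (lookup-zipWith lift i cs (map s ys)) (cong (lift (lookup cs i)) (lookup-map i s ys))

  code-injective : ∀ ys ys′ → SameCode₄ (code ys) (code ys′) → ys ≡ ys′
  code-injective ys ys′ same = begin
    ys                         ≡⟨ tabulate∘lookup ys ⟨
    tabulate (lookup ys)       ≡⟨ tabulate-cong pointwise ⟩
    tabulate (lookup ys′)      ≡⟨ tabulate∘lookup ys′ ⟩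
    ys′                        ∎
    where
    pointwise : ∀ i → lookup ys i ≡ lookup ys′ i
    pointwise i = lift-determined c y y′
      (subst₂ _∼_ (lookup-generators ys′ i) (lookup-generators ys i)
        (Generators.∼-generator ys (suc i) x∈ π≡))
      where
      c : Word₂ n
      c = lookup cs i
      y y′ : Word₂ M
      y = lookup ys i
      y′ = lookup ys′ i
      x : Word₄ n
      x = lookup (generators ys′) (suc i)
      x∈ : code ys x ≡ true
      x∈ = trans (same x) (Generators.generator∈generated ys′ (suc i))
      π≡ : π x ≡ π (lookup (generators ys) (suc i))
      π≡ = trans (cong π (lookup-generators ys′ i)) (trans (π-lift c (s y′)) (sym (trans (cong π (lookup-generators ys i)) (π-lift c (s y)))))

  code-surjective : ∀ C → Classified C → ∃ λ ys → ValidLifts cs (map s ys) × SameCode₄ C (code ys)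
  code-surjective C (C-code , C-even , one∈C , C-residue , C-torsion) =
    ys , Equivalence.from (validLifts⇔ cs (map s ys) cs∈C₁) (g₀⊥ , evens , pairs) ,
    Generators.generated-unique ys C C-code C-residue C-torsion gens∈C
    where
    open IsQuaternaryCode C-code
    -- adding a torsion word to a codeword over c kills the Span d part of its high part
    lift∈C : ∀ c → C₁ c ≡ true → ∃ λ y → C (lift c (s y)) ≡ true
    lift∈C c c∈ with Equivalence.to (C-residue c) c∈
    ... | x , x∈ , refl with decompose (high x)
    ... | α , y , high≡ = y , subst (λ z → C z ≡ true) x+ι≡ (closed-+ x _ x∈ (Equivalence.to (C-torsion _) (Equivalence.from (C₂-basis _) (α , refl))))
      where
      x+ι≡ : x +ᵥ ι (lincomb α d) ≡ lift (π x) (s y)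
      x+ι≡ = begin
        x +ᵥ ι (lincomb α d)                         ≡⟨ cong (_+ᵥ ι (lincomb α d)) (lift-π-high x) ⟨
        lift (π x) (high x) +ᵥ ι (lincomb α d)       ≡⟨ lift-+ᵥ-ι (π x) (high x) _ ⟩
        lift (π x) (high x ⊕ lincomb α d)            ≡⟨ cong (λ z → lift (π x) (z ⊕ lincomb α d)) (trans (sym high≡) (⊕-comm _ _)) ⟩
        lift (π x) ((s y ⊕ lincomb α d) ⊕ lincomb α d) ≡⟨ cong (lift (π x)) (⊕-cancelʳ (s y) _) ⟩
        lift (π x) (s y)                             ∎
    lifts∈C : ∀ {j} {cs′ : Vec (Word₂ n) j} → All (λ c → C₁ c ≡ true) cs′ →
              ∃ λ ys → All (λ g → C g ≡ true) (zipWith lift cs′ (map s ys))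
    lifts∈C []           = [] , []
    lifts∈C {cs′ = c ∷ _} (c∈ ∷ cs′∈) with lift∈C c c∈ | lifts∈C cs′∈
    ... | y , y∈ | ys , ys∈ = y ∷ ys , y∈ ∷ ys∈
    ys : Vec (Word₂ M) k
    ys = proj₁ (lifts∈C cs∈C₁)
    gens∈C : All (λ g → C g ≡ true) (generators ys)
    gens∈C = subst (λ g → C g ≡ true) (sym g₀≡one₄) one∈C ∷ proj₂ (lifts∈C cs∈C₁)
    even-generators : EvenSelfOrthogonal (generators ys)
    even-generators = even-code-evenSelfOrthogonal C-code C-even gens∈C
    g₀⊥ : All (λ g → dot₄ g₀ g ≡ z0) (zipWith lift cs (map s ys))
    g₀⊥ = AllPairs.head (proj₂ even-generators)
    evens : All (λ g → wtE₈ g ≡ [ 0 ]₈) (zipWith lift cs (map s ys))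
    evens = All.tail (proj₁ even-generators)
    pairs : AllPairs (λ g h → dot₄ g h ≡ z0) (zipWith lift cs (map s ys))
    pairs = AllPairs.tail (proj₂ even-generators)

  open Complement (complement (map sᵀ (one₂ ∷ cs)) (sᵀ-independent (one∈C₁ ∷ cs∈C₁) basis-independent))
    public using () renaming (dim to R; dim+K≡N to R+suc-k≡M)

  number-classified : NumberOfCodes₄ Classified (2 ^ triangular k R)
  number-classified = count-by-parametrisation (code ∘ point) (λ z → code-classified (point z) (valid z)) distinct complete
    where
    open Parametrisation (parametrise-lifts cs basis-independent cs∈C₁ R R+suc-k≡M)
    distinct : ∀ z z′ → SameCode₄ (code (point z)) (code (point z′)) → z ≡ z′
    distinct z z′ same = injective z z′ (code-injective (point z) (point z′) same)
    complete : ∀ C → Classified C → ∃ λ z → SameCode₄ C (code (point z))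
    complete C C-classified with code-surjective C C-classified
    ... | ys , valid-ys , same with surjective ys valid-ys
    ... | z , refl = z , same

2*triangular : ∀ j R → 2 ℕ.* triangular j R + j ≡ j ℕ.* (2 ℕ.* R + j)
2*triangular zero    R = refl
2*triangular (suc j) R = begin
  2 ℕ.* (triangular j (suc R) + R) + suc j              ≡⟨ solve 3 (λ t r j → con 2 :* (t :+ r) :+ (con 1 :+ j) := (con 2 :* t :+ j) :+ (con 2 :* r :+ con 1)) refl (triangular j (suc R)) R j ⟩
  (2 ℕ.* triangular j (suc R) + j) + (2 ℕ.* R + 1)      ≡⟨ cong (_+ (2 ℕ.* R + 1)) (2*triangular j (suc R)) ⟩
  j ℕ.* (2 ℕ.* suc R + j) + (2 ℕ.* R + 1)               ≡⟨ solve 2 (λ r j → j :* (con 2 :* (con 1 :+ r) :+ j) :+ (con 2 :* r :+ con 1) := (con 1 :+ j) :* (con 2 :* r :+ (con 1 :+ j))) refl R j ⟩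
  suc j ℕ.* (2 ℕ.* R + suc j)                           ∎
  where open Data.Nat.Solver.+-*-Solver

exponent-identity : ∀ {k R k₂ n} → (R + suc k) + (suc k + k₂) ≡ n →
  + (2 ℕ.* triangular k R) ≡ (+ suc k - + 1) * (+ 2 * + n - + 3 * + suc k - + 2 - + 2 * + k₂)
exponent-identity {k} {R} {k₂} refl = begin
  + (2 ℕ.* e)                                 ≡⟨ solve 2 (λ x k → x := (x :+ k) :- k) refl (+ (2 ℕ.* e)) (+ k) ⟩
  + (2 ℕ.* e + k) - + k                       ≡⟨ cong (λ x → + x - + k) (2*triangular k R) ⟩
  + (k ℕ.* (2 ℕ.* R + k)) - + k               ≡⟨ cong (_- + k) (trans (ℤP.pos-* k _) (cong (+ k *_) (cong (ℤ._+ + k) (ℤP.pos-* 2 R)))) ⟩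
  + k * (+ 2 * + R ℤ.+ + k) - + k             ≡⟨ solve 3 (λ k r k₂ → k :* (con (+ 2) :* r :+ k) :- k :=
                                                   ((con (+ 1) :+ k) :- con (+ 1)) :*
                                                   (con (+ 2) :* ((r :+ (con (+ 1) :+ k)) :+ ((con (+ 1) :+ k) :+ k₂))
                                                    :- con (+ 3) :* (con (+ 1) :+ k) :- con (+ 2) :- con (+ 2) :* k₂))
                                                 refl (+ k) (+ R) (+ k₂) ⟩
  (+ suc k - + 1) * (+ 2 * + ((R + suc k) + (suc k + k₂)) - + 3 * + suc k - + 2 - + 2 * + k₂) ∎
  where
  e : ℕ
  e = triangular k R
  open Data.Integer.Solver.+-*-Solver

one₂≢zero₂ : ∀ {n} → 0 < n → ¬ one₂ {n} ≡ zero₂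
one₂≢zero₂ {suc n} _ ()

theorem5p6 : (n : ℕ) → 0 < n → 8 ∣ n →
    (C₁ C₂ : Code₂ n) → IsBinaryLinear C₁ → IsBinaryLinear C₂ →
    C₁ ⊆₂ C₂ → (∀ y → C₂ y ≡ true → y ∈⊥ C₁) →
    DoublyEven C₁ → C₁ one₂ ≡ true →
    (k₁ k₂ : ℕ) → HasDim C₁ k₁ → HasDim C₂ (k₁ Data.Nat.+ k₂) →
    ∃ λ e →
      (+ (2 Data.Nat.* e) ≡ (+ k₁ - + 1) * (+ 2 * + n - + 3 * + k₁ - + 2 - + 2 * + k₂)) ×
      NumberOfCodes₄
        (λ C → IsQuaternaryCode C × EvenCode₄ C × C one₄ ≡ true × ResidueIs C C₁ × TorsionIs C C₂)
        (2 ^ e)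
theorem5p6 n 0<n 8∣n C₁ C₂ C₁-linear C₂-linear C₁⊆C₂ C₂⊥C₁ C₁-doublyEven one∈C₁ k₁ k₂ (b , C₁-span , b-independent) (d , C₂-span , d-independent)
  with basisThrough b (one₂≢zero₂ 0<n) b-independent (Equivalence.to (C₁-span one₂) one∈C₁)
... | record { size = k ; suc-size = refl ; rest = cs ; independent = cs-independent ; same-span = same-span } =
  triangular k R , exponent-identity (trans (cong (_+ (suc k + k₂)) R+suc-k≡M) M+K≡n) , number-classified
  where
  open Classification 8∣n C₁ C₂ C₁-linear C₂-linear C₁⊆C₂ C₂⊥C₁ C₁-doublyEven one∈C₁ cs (λ x → same-span x ⇔-∘ C₁-span x)
                      cs-independent d C₂-span d-independent
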